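{- Let $\mathbb{K}$ be a field, $V$ a two-dimensional $\mathbb{K}$-vector space, and $\mathcal{A}$ a finite set of distinct one-dimensional linear subspaces of $V$. If $\mu,\nu\in\Lambda$ and $\mu\mathrel{\dot\subset}\nu$, then $|\Delta(\mu)-\Delta(\nu)|=1$.
   Context: Let $S=\mathrm{Sym}(V^*)\cong\mathbb{K}[x,y]$, graded by polynomial degree; for $H\in\mathcal{A}$ fix $\alpha_H\in V^*$ with $\ker\alpha_H=H$. Let $\Lambda=\mathbb{N}^{|\mathcal{A}|}$, whose elements are multiplicities $\mu:\mathcal{A}\to\mathbb{N}$. For $\mu\in\Lambda$, $D(\mathcal{A},\mu)=\{\delta\in S\partial_x\oplus S\partial_y\mid \delta(\alpha_H)\in\alpha_H^{\mu_H}S\ \forall H\}$ is a free graded $S$-module of rank 2; if $(d_1,d_2)$ are the degrees of a homogeneous basis, $\Delta(\mu)=|d_1-d_2|$. $\mu\mathrel{\dot\subset}\nu$ means $\mu_H\le\nu_H$ for all $H$ and $\sum_H\nu_H=\sum_H\mu_H+1$. -}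

module Defs where

open import Level using (Level; _⊔_)
open import Data.Nat as ℕ using (ℕ; zero; suc; _≤_; _<_; _∸_; ∣_-_∣)
open import Data.Fin as Fin using (Fin; toℕ)
open import Data.Product using (Σ; _×_; _,_; ∃)
open import Data.List using (List; tabulate)
open import Data.Nat.ListAction using (sum)
open import Relation.Nullary using (¬_)
open import Relation.Binary.PropositionalEquality using (_≡_)
open import Algebra.Bundles using (CommutativeRing)

record Field (c ℓ : Level) : Set (Level.suc (c ⊔ ℓ)) where
  field
    commutativeRing : CommutativeRing c ℓ
  open CommutativeRing commutativeRing public
  field
    0≉1     : ¬ (0# ≈ 1#)
    inverse : ∀ x → ¬ (x ≈ 0#) → Σ Carrier (λ y → x * y ≈ 1#)

total : ∀ {n} → (Fin n → ℕ) → ℕ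
total μ = sum (tabulate μ)

_⊂·_ : ∀ {n} → (Fin n → ℕ) → (Fin n → ℕ) → Set
μ ⊂· ν = (∀ i → μ i ≤ ν i) × (total ν ≡ ℕ.suc (total μ))

module Over {c ℓ} (F : Field c ℓ) where
  open Field F hiding (zero)

  K : Set c
  K = Carrier

  -- Homogeneous polynomial of degree d in S = K[x,y]:
  -- p i is the coefficient of x^i y^(d-i), i = 0..d.
  Form : ℕ → Set c
  Form d = Fin (suc d) → K

  coef : ∀ {d} → Form d → ℕ → K
  coef {zero}  p zero    = p Fin.zero
  coef {zero}  p (suc k) = 0#
  coef {suc d} p zero    = p Fin.zero
  coef {suc d} p (suc k) = coef {d} (λ i → p (Fin.suc i)) k

  sumTo : ℕ → (ℕ → K) → K
  sumTo zero    f = f zero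
  sumTo (suc k) f = sumTo k f + f (suc k)

  conv : ∀ {a b} → Form a → Form b → ℕ → K
  conv p q k = sumTo k (λ i → coef p i * coef q (k ∸ i))

  mul : ∀ {a b} → Form a → Form b → Form (a ℕ.+ b)
  mul p q i = conv p q (toℕ i)

  _≈F_ : ∀ {d} → Form d → Form d → Set ℓ
  p ≈F q = ∀ i → p i ≈ q i

  zeroF : ∀ {d} → Form d
  zeroF _ = 0#

  -- a linear form α = a x + b y, given as the pair (a , b) ∈ V* ≅ K²
  Lin : Set c
  Lin = K × K

  linForm : Lin → Form 1
  linForm (a , b) Fin.zero     = b
  linForm (a , b) (Fin.suc _)  = a

  pow : Lin → (m : ℕ) → Form m
  pow α zero    _ = 1#
  pow α (suc m) = mul (linForm α) (pow α m)

  NonZeroLin : Lin → Set ℓ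
  NonZeroLin (a , b) = ¬ ((a ≈ 0#) × (b ≈ 0#))

  -- β is a nonzero scalar multiple of α, i.e. ker α = ker β
  SameLine : Lin → Lin → Set (c ⊔ ℓ)
  SameLine (a , b) (a' , b') =
    Σ K (λ t → ¬ (t ≈ 0#) × (a' ≈ t * a) × (b' ≈ t * b))

  -- A central arrangement of n distinct lines in V ≅ K², given by
  -- defining forms α_H, H ∈ Fin n.
  IsArrangement : ∀ {n} → (Fin n → Lin) → Set (c ⊔ ℓ)
  IsArrangement {n} α =
    (∀ i → NonZeroLin (α i)) × (∀ i j → ¬ (i ≡ j) → ¬ SameLine (α i) (α j))

  -- Homogeneous derivation θ = f ∂x + g ∂y of polynomial degree d.
  Der : ℕ → Set c
  Der d = Form d × Form d

  apply : ∀ {d} → Der d → Lin → Form d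
  apply (f , g) (a , b) i = a * f i + b * g i

  -- Homogeneous form h of degree e ∸ m that is "of degree e − m":
  -- when e < m it must vanish (there is no nonzero form of negative degree).
  Shifted : (e m : ℕ) → Form (e ∸ m) → Set ℓ
  Shifted e m h = e < m → h Fin.zero ≈ 0#

  DivBy : ∀ {e} → Lin → (m : ℕ) → Form e → Set (c ⊔ ℓ)
  DivBy {e} α m p =
    Σ (Form (e ∸ m)) λ h → Shifted e m h ×
      (∀ (i : Fin (suc e)) → p i ≈ conv (pow α m) h (toℕ i))

  InD : ∀ {n} → (Fin n → Lin) → (Fin n → ℕ) → ∀ {d} → Der d → Set (c ⊔ ℓ)
  InD α μ θ = ∀ H → DivBy (α H) (μ H) (apply θ (α H))

  comb : ∀ {e d₁ d₂} → Form (e ∸ d₁) → Der d₁ → Form (e ∸ d₂) → Der d₂ → Der e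
  comb f₁ (p₁ , q₁) f₂ (p₂ , q₂) =
    (λ i → conv f₁ p₁ (toℕ i) + conv f₂ p₂ (toℕ i)) ,
    (λ i → conv f₁ q₁ (toℕ i) + conv f₂ q₂ (toℕ i))

  _≈D_ : ∀ {d} → Der d → Der d → Set ℓ
  (f , g) ≈D (f' , g') = (f ≈F f') × (g ≈F g')

  zeroD : ∀ {d} → Der d
  zeroD = zeroF , zeroF

  -- θ₁, θ₂ (homogeneous of degrees d₁, d₂) form a homogeneous S-basis of
  -- the graded module D(A, μ): both lie in D(A, μ); every homogeneous
  -- element of D(A, μ) is an S-combination of them (coefficients
  -- homogeneous of the appropriate degree); and they are S-linearly
  -- independent (checked degree-wise, which suffices for graded modules).
  record HomBasis {n} (α : Fin n → Lin) (μ : Fin n → ℕ)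
                  (d₁ d₂ : ℕ) (θ₁ : Der d₁) (θ₂ : Der d₂) : Set (c ⊔ ℓ) where
    field
      mem₁ : InD α μ θ₁
      mem₂ : InD α μ θ₂
      spans : ∀ e (δ : Der e) → InD α μ δ →
        Σ (Form (e ∸ d₁)) λ f₁ → Σ (Form (e ∸ d₂)) λ f₂ →
          Shifted e d₁ f₁ × Shifted e d₂ f₂ × (δ ≈D comb f₁ θ₁ f₂ θ₂)
      indep : ∀ e (f₁ : Form (e ∸ d₁)) (f₂ : Form (e ∸ d₂)) →
          Shifted e d₁ f₁ → Shifted e d₂ f₂ →
          comb {e} f₁ θ₁ f₂ θ₂ ≈D zeroD → (f₁ ≈F zeroF) × (f₂ ≈F zeroF)

module Submission where

-- Let H₀ be the line with ν(H₀) = μ(H₀) + 1, with form α₀ = a₀x + b₀y; then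
-- α₀ D(μ) ⊆ D(ν) ⊆ D(μ).  In a graded free module of rank 2 with basis degrees
-- d₁ ≤ d₂, an independent pair of degrees e₁ ≤ e₂ has dᵢ ≤ eᵢ, and is again a
-- basis if eᵢ = dᵢ (Cramer's rule).  Both inclusions thus give dᵢ ≤ eᵢ ≤ dᵢ + 1
-- for sorted degrees.  With R = ∏_{H ≠ H₀} α_H^μ(H), the extreme cases fail:
-- eᵢ = dᵢ would make D(ν) = D(μ), but σ = α₀^μ(H₀) R (s∂x + t∂y), α₀(s,t) = 1,
-- lies in D(μ) \ D(ν); eᵢ = dᵢ + 1 would make D(ν) = α₀ D(μ), but ρ = R (b₀∂x − a₀∂y)
-- lies in D(ν) and does not vanish at the point (b₀, −a₀) of H₀.
--
-- Cancellation of a linear form is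
-- only proved up to double negation, as equality in K is undecidable; all
-- conclusions drawn from it are negative.

open import Defs
open import Level using (Level; _⊔_)
open import Data.Nat as ℕ using (ℕ; zero; suc; _∸_; _≤_; _<_; z≤n; s≤s; ∣_-_∣)
import Data.Nat.Properties as NP
open import Data.Product using (Σ; _×_; _,_; proj₁; proj₂)
open import Data.Sum using (_⊎_; inj₁; inj₂)
open import Data.Empty using (⊥-elim)
open import Function using (case_of_)
open import Relation.Nullary using (¬_; yes; no)
open import Data.Fin as Fin using (Fin; toℕ)
import Relation.Binary.PropositionalEquality as PE
open PE using (_≡_)
open import Algebra.Bundles using (CommutativeRing)
import Algebra.Properties.Ring as RingProperties
import Algebra.Solver.Ring.NaturalCoefficients.Default as NCD
import Algebra.Construct.Pointwise as Pointwise
import Relation.Binary.Reasoning.Setoid as SetoidReasoning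

-- Used over the ring of coefficient sequences, where they
-- compare two pairs of derivations expressed in a common basis.
module TwoByTwo {c ℓ} (R : CommutativeRing c ℓ) where
  open CommutativeRing R
  open SetoidReasoning setoid
  open NCD commutativeSemiring using (solve; _:=_; _:+_; _:*_)
  open RingProperties ring using (-‿distribˡ-*)

  det : Carrier → Carrier → Carrier → Carrier → Carrier
  det m11 m12 m21 m22 = m11 * m22 + (- m12) * m21

  multiples-dependent : ∀ f1 f2 p X1 X2 → X1 ≈ f1 * p → X2 ≈ f2 * p →
                        f2 * X1 + (- f1) * X2 ≈ 0#
  multiples-dependent f1 f2 p X1 X2 e1 e2 = begin
      f2 * X1 + (- f1) * X2
    ≈⟨ +-cong (*-cong refl e1) (*-cong refl e2) ⟩
      f2 * (f1 * p) + (- f1) * (f2 * p)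
    ≈⟨ +-cong refl (sym (-‿distribˡ-* f1 _)) ⟩
      f2 * (f1 * p) + - (f1 * (f2 * p))
    ≈⟨ +-cong refl (-‿cong (solve 3 (λ a b p → a :* (b :* p) := b :* (a :* p)) refl f1 f2 p)) ⟩
      f2 * (f1 * p) + - (f2 * (f1 * p))
    ≈⟨ -‿inverseʳ _ ⟩
      0# ∎

  adjugate₁ : ∀ m11 m12 m21 m22 p q X1 X2 → X1 ≈ m11 * p + m12 * q → X2 ≈ m21 * p + m22 * q →
              m22 * X1 + (- m12) * X2 ≈ det m11 m12 m21 m22 * p
  adjugate₁ m11 m12 m21 m22 p q X1 X2 e1 e2 = begin
      m22 * X1 + (- m12) * X2
    ≈⟨ +-cong (*-cong refl e1) (*-cong refl e2) ⟩
      m22 * (m11 * p + m12 * q) + (- m12) * (m21 * p + m22 * q)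
    ≈⟨ solve 7 (λ m11 m12 m21 m22 p q u → m22 :* (m11 :* p :+ m12 :* q) :+ u :* (m21 :* p :+ m22 :* q)
                 := (m11 :* m22 :+ u :* m21) :* p :+ (m12 :+ u) :* (m22 :* q)) refl m11 m12 m21 m22 p q (- m12) ⟩
      det m11 m12 m21 m22 * p + (m12 + - m12) * (m22 * q)
    ≈⟨ +-cong refl (trans (*-cong (-‿inverseʳ m12) refl) (zeroˡ _)) ⟩
      det m11 m12 m21 m22 * p + 0#
    ≈⟨ +-identityʳ _ ⟩
      det m11 m12 m21 m22 * p ∎

  adjugate₂ : ∀ m11 m12 m21 m22 p q X1 X2 → X1 ≈ m11 * p + m12 * q → X2 ≈ m21 * p + m22 * q →
              (- m21) * X1 + m11 * X2 ≈ det m11 m12 m21 m22 * q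
  adjugate₂ m11 m12 m21 m22 p q X1 X2 e1 e2 = begin
      (- m21) * X1 + m11 * X2
    ≈⟨ +-cong (*-cong refl e1) (*-cong refl e2) ⟩
      (- m21) * (m11 * p + m12 * q) + m11 * (m21 * p + m22 * q)
    ≈⟨ solve 7 (λ m11 m12 m21 m22 p q v → v :* (m11 :* p :+ m12 :* q) :+ m11 :* (m21 :* p :+ m22 :* q)
                 := (v :+ m21) :* (m11 :* p) :+ (m11 :* m22 :+ v :* m12) :* q) refl m11 m12 m21 m22 p q (- m21) ⟩
      (- m21 + m21) * (m11 * p) + (m11 * m22 + (- m21) * m12) * q
    ≈⟨ +-cong (trans (*-cong (-‿inverseˡ m21) refl) (zeroˡ _)) (*-cong (+-cong refl swap) refl) ⟩
      0# + det m11 m12 m21 m22 * q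
    ≈⟨ +-identityˡ _ ⟩
      det m11 m12 m21 m22 * q ∎
    where
    swap : (- m21) * m12 ≈ (- m12) * m21
    swap = trans (sym (-‿distribˡ-* m21 m12)) (trans (-‿cong (*-comm m21 m12)) (-‿distribˡ-* m12 m21))

  -- Cramer's rule: if det(M) has an inverse C, anything in the span of (p, q)
  -- is in the span of (X₁, X₂), with the coefficients C·(h·adj M).
  cramer : ∀ C h1 h2 m11 m12 m21 m22 p q X1 X2 Y → C * det m11 m12 m21 m22 ≈ 1# →
           Y ≈ h1 * p + h2 * q → X1 ≈ m11 * p + m12 * q → X2 ≈ m21 * p + m22 * q →
           Y ≈ (C * (h1 * m22 + h2 * (- m21))) * X1 + (C * (h1 * (- m12) + h2 * m11)) * X2
  cramer C h1 h2 m11 m12 m21 m22 p q X1 X2 Y CD≈1 eY e1 e2 = sym (begin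
      (C * (h1 * m22 + h2 * (- m21))) * X1 + (C * (h1 * (- m12) + h2 * m11)) * X2
    ≈⟨ solve 9 (λ C h1 h2 m22 u v m11 X1 X2 → (C :* (h1 :* m22 :+ h2 :* v)) :* X1 :+ (C :* (h1 :* u :+ h2 :* m11)) :* X2
          := C :* (h1 :* (m22 :* X1 :+ u :* X2) :+ h2 :* (v :* X1 :+ m11 :* X2))) refl C h1 h2 m22 (- m12) (- m21) m11 X1 X2 ⟩
      C * (h1 * (m22 * X1 + (- m12) * X2) + h2 * ((- m21) * X1 + m11 * X2))
    ≈⟨ *-cong refl (+-cong (*-cong refl (adjugate₁ m11 m12 m21 m22 p q X1 X2 e1 e2))
                           (*-cong refl (adjugate₂ m11 m12 m21 m22 p q X1 X2 e1 e2))) ⟩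
      C * (h1 * (D * p) + h2 * (D * q))
    ≈⟨ solve 6 (λ C D h1 h2 p q → C :* (h1 :* (D :* p) :+ h2 :* (D :* q)) := (C :* D) :* (h1 :* p :+ h2 :* q)) refl C D h1 h2 p q ⟩
      (C * D) * (h1 * p + h2 * q)
    ≈⟨ *-cong CD≈1 (sym eY) ⟩
      1# * Y
    ≈⟨ *-identityˡ Y ⟩
      Y ∎)
    where D = det m11 m12 m21 m22

-- Coefficient sequences ℕ → K under convolution: a commutative ring in which
-- "degree ≤ d" means vanishing beyond index d.
module SequenceRing {c ℓ} (F : Field c ℓ) where
  open Field F hiding (zero)
  open Over F
  open SetoidReasoning setoid
  open NCD commutativeSemiring using (solve; _:=_; _:+_; _:*_)

  sumTo-cong : ∀ k {f g : ℕ → K} → (∀ i → i ≤ k → f i ≈ g i) → sumTo k f ≈ sumTo k g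
  sumTo-cong zero e = e 0 z≤n
  sumTo-cong (suc k) e = +-cong (sumTo-cong k (λ i p → e i (NP.m≤n⇒m≤1+n p))) (e (suc k) NP.≤-refl)

  sumTo-zero : ∀ k {f : ℕ → K} → (∀ i → i ≤ k → f i ≈ 0#) → sumTo k f ≈ 0#
  sumTo-zero k e = trans (sumTo-cong k e) (sumTo-const0 k)
    where
    sumTo-const0 : ∀ k → sumTo k (λ _ → 0#) ≈ 0#
    sumTo-const0 zero = refl
    sumTo-const0 (suc k) = trans (+-cong (sumTo-const0 k) refl) (+-identityˡ 0#)

  sumTo-+ : ∀ k (f g : ℕ → K) → sumTo k (λ i → f i + g i) ≈ sumTo k f + sumTo k g
  sumTo-+ zero f g = refl
  sumTo-+ (suc k) f g = begin
      sumTo k (λ i → f i + g i) + (f (suc k) + g (suc k))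
    ≈⟨ +-cong (sumTo-+ k f g) refl ⟩
      (sumTo k f + sumTo k g) + (f (suc k) + g (suc k))
    ≈⟨ solve 4 (λ a b x y → (a :+ b) :+ (x :+ y) := (a :+ x) :+ (b :+ y)) refl (sumTo k f) (sumTo k g) (f (suc k)) (g (suc k)) ⟩
      (sumTo k f + f (suc k)) + (sumTo k g + g (suc k)) ∎

  sumTo-* : ∀ k a (f : ℕ → K) → sumTo k (λ i → a * f i) ≈ a * sumTo k f
  sumTo-* zero a f = refl
  sumTo-* (suc k) a f = trans (+-cong (sumTo-* k a f) refl) (sym (distribˡ a _ _))

  sumTo-peel : ∀ k (f : ℕ → K) → sumTo (suc k) f ≈ f 0 + sumTo k (λ i → f (suc i))
  sumTo-peel zero f = refl
  sumTo-peel (suc k) f = trans (+-cong (sumTo-peel k f) refl) (+-assoc _ _ _)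

  sumTo-rev : ∀ k (f : ℕ → K) → sumTo k f ≈ sumTo k (λ i → f (k ∸ i))
  sumTo-rev zero f = refl
  sumTo-rev (suc k) f = begin
      sumTo k f + f (suc k)
    ≈⟨ +-cong (sumTo-rev k f) refl ⟩
      sumTo k (λ i → f (k ∸ i)) + f (suc k)
    ≈⟨ +-comm _ _ ⟩
      f (suc k) + sumTo k (λ i → f (k ∸ i))
    ≈⟨ sym (sumTo-peel k (λ i → f (suc k ∸ i))) ⟩
      sumTo (suc k) (λ i → f (suc k ∸ i)) ∎

  Seq : Set c
  Seq = ℕ → K

  infix 4 _≈S_
  _≈S_ : Seq → Seq → Set ℓ
  s ≈S t = ∀ k → s k ≈ t k

  infixl 6 _+S_
  infixl 7 _⋆_
  _+S_ : Seq → Seq → Seq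
  (s +S t) k = s k + t k

  negS : Seq → Seq
  negS s k = - s k

  0S : Seq
  0S _ = 0#

  1S : Seq
  1S zero = 1#
  1S (suc k) = 0#

  _⋆_ : Seq → Seq → Seq
  (s ⋆ t) k = sumTo k (λ i → s i * t (k ∸ i))

  _·S_ : K → Seq → Seq
  (a ·S s) k = a * s k

  shiftS : Seq → Seq
  shiftS s k = s (suc k)

  ≈S-refl : ∀ {s} → s ≈S s
  ≈S-refl k = refl

  ≈S-sym : ∀ {s t} → s ≈S t → t ≈S s
  ≈S-sym e k = sym (e k)

  ≈S-trans : ∀ {s t u} → s ≈S t → t ≈S u → s ≈S u
  ≈S-trans e1 e2 k = trans (e1 k) (e2 k)

  +S-cong : ∀ {s s' t t'} → s ≈S s' → t ≈S t' → s +S t ≈S s' +S t'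
  +S-cong e1 e2 k = +-cong (e1 k) (e2 k)

  ⋆-cong : ∀ {s s' t t'} → s ≈S s' → t ≈S t' → s ⋆ t ≈S s' ⋆ t'
  ⋆-cong e1 e2 k = sumTo-cong k (λ i _ → *-cong (e1 i) (e2 (k ∸ i)))

  ⋆-congˡ : ∀ s {t t'} → t ≈S t' → s ⋆ t ≈S s ⋆ t'
  ⋆-congˡ s e = ⋆-cong {s = s} {s' = s} ≈S-refl e

  ⋆-comm : ∀ s t → s ⋆ t ≈S t ⋆ s
  ⋆-comm s t k = trans (sumTo-rev k _) (sumTo-cong k λ i i≤k → trans (*-comm _ _)
     (*-cong (reflexive (PE.cong t (NP.m∸[m∸n]≡n i≤k))) refl))

  ⋆-distribʳ : ∀ s t u → (s +S t) ⋆ u ≈S s ⋆ u +S t ⋆ u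
  ⋆-distribʳ s t u k = trans (sumTo-cong k (λ i _ → distribʳ _ _ _)) (sumTo-+ k _ _)

  ⋆-distribˡ : ∀ u s t → u ⋆ (s +S t) ≈S u ⋆ s +S u ⋆ t
  ⋆-distribˡ u s t k = trans (⋆-comm u (s +S t) k) (trans (⋆-distribʳ s t u k)
     (+-cong (⋆-comm s u k) (⋆-comm t u k)))

  ⋆-scal : ∀ a s t → (a ·S s) ⋆ t ≈S a ·S (s ⋆ t)
  ⋆-scal a s t k = trans (sumTo-cong k (λ i _ → *-assoc _ _ _)) (sumTo-* k a _)

  ⋆-zeroˡ : ∀ {s} t → s ≈S 0S → s ⋆ t ≈S 0S
  ⋆-zeroˡ {s} t z k = sumTo-zero k (λ i _ → trans (*-cong (z i) refl) (zeroˡ _))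

  ⋆-zeroʳ : ∀ s {t} → t ≈S 0S → s ⋆ t ≈S 0S
  ⋆-zeroʳ s {t} z k = trans (⋆-comm s t k) (⋆-zeroˡ s z k)

  ⋆-identityˡ : ∀ s → 1S ⋆ s ≈S s
  ⋆-identityˡ s zero = *-identityˡ _
  ⋆-identityˡ s (suc k) = begin
      (1S ⋆ s) (suc k)
    ≈⟨ sumTo-peel k _ ⟩
      1# * s (suc k) + sumTo k (λ i → 0# * s (k ∸ i))
    ≈⟨ +-cong (*-identityˡ _) (sumTo-zero k (λ i _ → zeroˡ _)) ⟩
      s (suc k) + 0#
    ≈⟨ +-identityʳ _ ⟩
      s (suc k) ∎

  ⋆-identityʳ : ∀ s → s ⋆ 1S ≈S s
  ⋆-identityʳ s k = trans (⋆-comm s 1S k) (⋆-identityˡ s k)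

  ⋆-shift : ∀ s t → shiftS (s ⋆ t) ≈S (s 0 ·S shiftS t) +S (shiftS s ⋆ t)
  ⋆-shift s t k = sumTo-peel k _

  ⋆-assoc : ∀ s t u → (s ⋆ t) ⋆ u ≈S s ⋆ (t ⋆ u)
  ⋆-assoc s t u zero = *-assoc _ _ _
  ⋆-assoc s t u (suc k) = begin
      ((s ⋆ t) ⋆ u) (suc k)
    ≈⟨ ⋆-shift (s ⋆ t) u k ⟩
      (s 0 * t 0) * u (suc k) + (shiftS (s ⋆ t) ⋆ u) k
    ≈⟨ +-cong refl (⋆-cong {t = u} {t' = u} (⋆-shift s t) ≈S-refl k) ⟩
      (s 0 * t 0) * u (suc k) + (((s 0 ·S shiftS t) +S (shiftS s ⋆ t)) ⋆ u) k
    ≈⟨ +-cong refl (trans (⋆-distribʳ _ _ u k) (+-cong (⋆-scal _ _ u k) (⋆-assoc (shiftS s) t u k))) ⟩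
      (s 0 * t 0) * u (suc k) + (s 0 * (shiftS t ⋆ u) k + (shiftS s ⋆ (t ⋆ u)) k)
    ≈⟨ solve 5 (λ a b U A B → (a :* b) :* U :+ (a :* A :+ B) := a :* (b :* U :+ A) :+ B) refl
         (s 0) (t 0) (u (suc k)) ((shiftS t ⋆ u) k) ((shiftS s ⋆ (t ⋆ u)) k) ⟩
      s 0 * (t 0 * u (suc k) + (shiftS t ⋆ u) k) + (shiftS s ⋆ (t ⋆ u)) k
    ≈⟨ +-cong (*-cong refl (sym (⋆-shift t u k))) refl ⟩
      s 0 * (t ⋆ u) (suc k) + (shiftS s ⋆ (t ⋆ u)) k
    ≈⟨ sym (⋆-shift s (t ⋆ u) k) ⟩
      (s ⋆ (t ⋆ u)) (suc k) ∎

  seqRing : CommutativeRing c ℓ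
  seqRing = record
    { Carrier = Seq ; _≈_ = _≈S_ ; _+_ = _+S_ ; _*_ = _⋆_ ; -_ = negS ; 0# = 0S ; 1# = 1S
    ; isCommutativeRing = record
      { isRing = record
        { +-isAbelianGroup = Pointwise.isAbelianGroup ℕ +-isAbelianGroup
        ; *-cong = ⋆-cong
        ; *-assoc = ⋆-assoc
        ; *-identity = ⋆-identityˡ , ⋆-identityʳ
        ; distrib = ⋆-distribˡ , (λ u s t → ⋆-distribʳ s t u) }
      ; *-comm = ⋆-comm } }

  module SeqSolver = NCD (CommutativeRing.commutativeSemiring seqRing)

  ⋆-exchange : ∀ s t u → s ⋆ (t ⋆ u) ≈S t ⋆ (s ⋆ u)
  ⋆-exchange = SeqSolver.solve 3 (λ a b c → a SeqSolver.:* (b SeqSolver.:* c) SeqSolver.:= b SeqSolver.:* (a SeqSolver.:* c)) ≈S-refl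

  Deg≤ : ℕ → Seq → Set ℓ
  Deg≤ d s = ∀ k → d < k → s k ≈ 0#

  Deg≤-≡ : ∀ {d d' s} → d ≡ d' → Deg≤ d s → Deg≤ d' s
  Deg≤-≡ PE.refl b = b

  Deg≤-resp : ∀ {d s t} → s ≈S t → Deg≤ d s → Deg≤ d t
  Deg≤-resp e b k lt = trans (sym (e k)) (b k lt)

  Deg≤-zero : ∀ {d s} → s ≈S 0S → Deg≤ d s
  Deg≤-zero z k _ = z k

  Deg≤-1S : Deg≤ 0 1S
  Deg≤-1S (suc k) _ = refl

  Deg≤-+ : ∀ {d s t} → Deg≤ d s → Deg≤ d t → Deg≤ d (s +S t)
  Deg≤-+ b1 b2 k lt = trans (+-cong (b1 k lt) (b2 k lt)) (+-identityˡ 0#)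

  Deg≤-neg : ∀ {d s} → Deg≤ d s → Deg≤ d (negS s)
  Deg≤-neg b k lt = trans (-‿cong (b k lt)) -0#≈0#
    where open RingProperties ring using (-0#≈0#)

  Deg≤-· : ∀ {d s} a → Deg≤ d s → Deg≤ d (a ·S s)
  Deg≤-· a b k lt = trans (*-cong refl (b k lt)) (zeroʳ _)

  Deg≤-⋆ : ∀ {a b s t} → Deg≤ a s → Deg≤ b t → Deg≤ (a ℕ.+ b) (s ⋆ t)
  Deg≤-⋆ {a} {b} {s} {t} bs bt k lt = sumTo-zero k term
    where
    term : ∀ i → i ≤ k → s i * t (k ∸ i) ≈ 0#
    term i i≤k with i NP.≤? a
    ... | yes i≤a = trans (*-cong refl (bt (k ∸ i) (NP.m+n≤o⇒m≤o∸n (suc b) big))) (zeroʳ _)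
      where
      big : suc b ℕ.+ i ≤ k
      big = NP.≤-trans (NP.+-monoʳ-≤ (suc b) i≤a)
              (NP.≤-trans (NP.≤-reflexive (PE.cong suc (NP.+-comm b a))) lt)
    ... | no i≰a = trans (*-cong (bs i (NP.≰⇒> i≰a)) refl) (zeroˡ _)

  const-shift : ∀ {s} → Deg≤ 0 s → shiftS s ≈S 0S
  const-shift b k = b (suc k) (s≤s z≤n)

  const-⋆ : ∀ {s} t → Deg≤ 0 s → s ⋆ t ≈S s 0 ·S t
  const-⋆ t b zero = refl
  const-⋆ {s} t b (suc k) = trans (⋆-shift s t k) (trans (+-cong refl (⋆-zeroˡ t (const-shift b) k)) (+-identityʳ _))

  -- Mult e d f: f is a multiplier taking degree d to degree e, i.e. a form of
  -- degree e − d, which must vanish when e < d (no negative degrees).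
  Mult : ℕ → ℕ → Seq → Set ℓ
  Mult e d f = Deg≤ (e ∸ d) f × (e < d → f ≈S 0S)

  Mult-⋆ : ∀ {e d f t} → Mult e d f → Deg≤ d t → Deg≤ e (f ⋆ t)
  Mult-⋆ {e} {d} {f} {t} (bf , zf) bt with e NP.<? d
  ... | yes lt = Deg≤-zero (⋆-zeroˡ t (zf lt))
  ... | no nlt = Deg≤-≡ (NP.m∸n+n≡m (NP.≮⇒≥ nlt)) (Deg≤-⋆ bf bt)

  Mult-⋆' : ∀ {e d f t} → Mult e d f → Deg≤ d t → Deg≤ e (t ⋆ f)
  Mult-⋆' {f = f} {t} mf bt = Deg≤-resp (⋆-comm f t) (Mult-⋆ mf bt)

  Mult-0S : ∀ e d → Mult e d 0S
  Mult-0S e d = Deg≤-zero ≈S-refl , λ _ → ≈S-refl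

  Mult-neg : ∀ {e d f} → Mult e d f → Mult e d (negS f)
  Mult-neg (b , z) = Deg≤-neg b , λ lt k → trans (-‿cong (z lt k)) -0#≈0#
    where open RingProperties ring using (-0#≈0#)

  Mult-const : ∀ {e f} → Deg≤ 0 f → Mult e e f
  Mult-const {e} b = Deg≤-≡ (PE.sym (NP.n∸n≡0 e)) b , λ lt → ⊥-elim (NP.n≮n e lt)

  Mult-const⁻¹ : ∀ {e f} → Mult e e f → Deg≤ 0 f
  Mult-const⁻¹ {e} (b , _) = Deg≤-≡ (NP.n∸n≡0 e) b

  Mult-+ : ∀ {e d f g} → Mult e d f → Mult e d g → Mult e d (f +S g)
  Mult-+ (bf , zf) (bg , zg) = Deg≤-+ bf bg , λ lt k → trans (+-cong (zf lt k) (zg lt k)) (+-identityˡ 0#)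

  Mult-⋆-Mult : ∀ {k b a f g} → Mult k b f → Mult b a g → Mult k a (f ⋆ g)
  Mult-⋆-Mult {k} {b} {a} {f} {g} (bf , zf) (bg , zg) = degree , vanishing
    where
    degree : Deg≤ (k ∸ a) (f ⋆ g)
    degree with k NP.<? b | b NP.<? a
    ... | yes k<b | _ = Deg≤-zero (⋆-zeroˡ g (zf k<b))
    ... | no _ | yes b<a = Deg≤-zero (⋆-zeroʳ f (zg b<a))
    ... | no k≮b | no b≮a = Deg≤-≡ (∸-chain (NP.≮⇒≥ b≮a) (NP.≮⇒≥ k≮b)) (Deg≤-⋆ bf bg)
      where
      ∸-chain : ∀ {a b k} → a ≤ b → b ≤ k → (k ∸ b) ℕ.+ (b ∸ a) ≡ k ∸ a
      ∸-chain {a} {b} {k} a≤b b≤k = PE.trans (PE.sym (NP.+-∸-assoc (k ∸ b) a≤b)) (PE.cong (_∸ a) (NP.m∸n+n≡m b≤k))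
    vanishing : k < a → f ⋆ g ≈S 0S
    vanishing k<a with k NP.<? b
    ... | yes k<b = ⋆-zeroˡ g (zf k<b)
    ... | no k≮b = ⋆-zeroʳ f (zg (NP.≤-<-trans (NP.≮⇒≥ k≮b) k<a))

  Mult-cancel : ∀ m {e d f} → Mult (m ℕ.+ e) (m ℕ.+ d) f → Mult e d f
  Mult-cancel m {e} {d} (b , z) = Deg≤-≡ (NP.[m+n]∸[m+o]≡n∸o m e d) b , λ lt → z (NP.+-monoʳ-< m lt)

  Deg≤⇒Mult : ∀ {d f} → Deg≤ d f → Mult (suc d) 1 f
  Deg≤⇒Mult b = b , λ { (s≤s ()) }

  Mult-pred : ∀ {e d f} → Mult e (suc d) f → Mult (e ∸ 1) d f
  Mult-pred {e} {d} (b , z) = Deg≤-≡ (PE.sym (NP.∸-+-assoc e 1 d)) b , λ lt → z (lemma e lt)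
    where
    lemma : ∀ e → e ∸ 1 < d → e < suc d
    lemma zero _ = s≤s z≤n
    lemma (suc e) lt = s≤s lt

module FormsAsSequences {c ℓ} (F : Field c ℓ) where
  open Field F hiding (zero)
  open Over F
  open SequenceRing F

  coef-deg : ∀ d (p : Form d) → Deg≤ d (coef p)
  coef-deg zero p (suc k) _ = refl
  coef-deg (suc d) p (suc k) (s≤s lt) = coef-deg d (λ i → p (Fin.suc i)) k lt

  coef-at : ∀ d (p : Form d) (i : Fin (suc d)) → coef p (toℕ i) ≡ p i
  coef-at zero p Fin.zero = PE.refl
  coef-at (suc d) p Fin.zero = PE.refl
  coef-at (suc d) p (Fin.suc i) = coef-at d (λ j → p (Fin.suc j)) i

  coef-cong : ∀ d (p q : Form d) → p ≈F q → coef p ≈S coef q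
  coef-cong zero p q e zero = e Fin.zero
  coef-cong zero p q e (suc k) = refl
  coef-cong (suc d) p q e zero = e Fin.zero
  coef-cong (suc d) p q e (suc k) = coef-cong d _ _ (λ i → e (Fin.suc i)) k

  form : ∀ d → Seq → Form d
  form d s i = s (toℕ i)

  coef-form-≤ : ∀ d (s : Seq) k → k ≤ d → coef (form d s) k ≡ s k
  coef-form-≤ zero s zero _ = PE.refl
  coef-form-≤ (suc d) s zero _ = PE.refl
  coef-form-≤ (suc d) s (suc k) (s≤s le) = coef-form-≤ d (λ j → s (suc j)) k le

  coef-form : ∀ d s → Deg≤ d s → coef (form d s) ≈S s
  coef-form d s b k with k NP.≤? d
  ... | yes le = reflexive (coef-form-≤ d s k le)
  ... | no nle = trans (coef-deg d _ k (NP.≰⇒> nle)) (sym (b k (NP.≰⇒> nle)))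

  coef-char : ∀ d (p : Form d) s → Deg≤ d s → (∀ i → p i ≈ s (toℕ i)) → coef p ≈S s
  coef-char d p s b e k = trans (coef-cong d p (form d s) e k) (coef-form d s b k)

  coef-mul : ∀ a b (p : Form a) (q : Form b) → coef (mul p q) ≈S coef p ⋆ coef q
  coef-mul a b p q = coef-char (a ℕ.+ b) (mul p q) _ (Deg≤-⋆ (coef-deg a p) (coef-deg b q)) (λ i → refl)

  shifted-zero : ∀ e m (h : Form (e ∸ m)) → Shifted e m h → e < m → coef h ≈S 0S
  shifted-zero e m h sh lt zero = trans (reflexive (coef-at (e ∸ m) h Fin.zero)) (sh lt)
  shifted-zero e m h sh lt (suc k) =
    coef-deg (e ∸ m) h (suc k) (s≤s (NP.≤-trans (NP.≤-reflexive (NP.m≤n⇒m∸n≡0 (NP.<⇒≤ lt))) z≤n))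

  Shifted⇒Mult : ∀ e m (h : Form (e ∸ m)) → Shifted e m h → Mult e m (coef h)
  Shifted⇒Mult e m h sh = coef-deg (e ∸ m) h , shifted-zero e m h sh

  linS : Lin → Seq
  linS β = coef (linForm β)

  powS : Lin → ℕ → Seq
  powS β m = coef (pow β m)

  linS-deg : ∀ β → Deg≤ 1 (linS β)
  linS-deg β = coef-deg 1 (linForm β)

  powS-deg : ∀ β m → Deg≤ m (powS β m)
  powS-deg β m = coef-deg m (pow β m)

  powS-zero : ∀ β → powS β 0 ≈S 1S
  powS-zero β zero = refl
  powS-zero β (suc k) = refl

  powS-suc : ∀ β m → powS β (suc m) ≈S linS β ⋆ powS β m
  powS-suc β m = coef-mul 1 m (linForm β) (pow β m)

  powS-suc-⋆ : ∀ β m x → powS β (suc m) ⋆ x ≈S linS β ⋆ (powS β m ⋆ x)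
  powS-suc-⋆ β m x = ≈S-trans (⋆-cong {t = x} (powS-suc β m) ≈S-refl) (⋆-assoc (linS β) (powS β m) x)

  SDer : Set c
  SDer = Seq × Seq

  infix 4 _≈SD_
  _≈SD_ : SDer → SDer → Set ℓ
  (f , g) ≈SD (f' , g') = (f ≈S f') × (g ≈S g')

  ≈SD-sym : ∀ {δ δ'} → δ ≈SD δ' → δ' ≈SD δ
  ≈SD-sym (e1 , e2) = ≈S-sym e1 , ≈S-sym e2

  ≈SD-trans : ∀ {δ δ' δ''} → δ ≈SD δ' → δ' ≈SD δ'' → δ ≈SD δ''
  ≈SD-trans (e1 , e2) (e3 , e4) = ≈S-trans e1 e3 , ≈S-trans e2 e4

  0SD : SDer
  0SD = 0S , 0S

  DerDeg≤ : ℕ → SDer → Set ℓ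
  DerDeg≤ d (f , g) = Deg≤ d f × Deg≤ d g

  applyS : SDer → Lin → Seq
  applyS (f , g) (a , b) = a ·S f +S b ·S g

  combS : Seq → SDer → Seq → SDer → SDer
  combS g1 (p1 , q1) g2 (p2 , q2) = g1 ⋆ p1 +S g2 ⋆ p2 , g1 ⋆ q1 +S g2 ⋆ q2

  derSeq : ∀ {d} → Der d → SDer
  derSeq (f , g) = coef f , coef g

  derSeq-deg : ∀ {d} (θ : Der d) → DerDeg≤ d (derSeq θ)
  derSeq-deg {d} (f , g) = coef-deg d f , coef-deg d g

  applyS-deg : ∀ {d δ} β → DerDeg≤ d δ → Deg≤ d (applyS δ β)
  applyS-deg (a , b) (b1 , b2) = Deg≤-+ (Deg≤-· a b1) (Deg≤-· b b2)

  coef-apply : ∀ {d} (θ : Der d) β → coef (apply θ β) ≈S applyS (derSeq θ) β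
  coef-apply {d} (f , g) (a , b) = coef-char d _ _ (applyS-deg (a , b) (derSeq-deg (f , g)))
    (λ i → +-cong (*-cong refl (reflexive (PE.sym (coef-at d f i)))) (*-cong refl (reflexive (PE.sym (coef-at d g i)))))

  combS-deg : ∀ {e d1 d2 g1 g2 δ1 δ2} → Mult e d1 g1 → Mult e d2 g2 → DerDeg≤ d1 δ1 → DerDeg≤ d2 δ2 →
              DerDeg≤ e (combS g1 δ1 g2 δ2)
  combS-deg m1 m2 (b1 , b1') (b2 , b2') = Deg≤-+ (Mult-⋆ m1 b1) (Mult-⋆ m2 b2) , Deg≤-+ (Mult-⋆ m1 b1') (Mult-⋆ m2 b2')

  coef-comb : ∀ e d1 d2 (f1 : Form (e ∸ d1)) (θ1 : Der d1) (f2 : Form (e ∸ d2)) (θ2 : Der d2) →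
              Mult e d1 (coef f1) → Mult e d2 (coef f2) →
              derSeq (comb {e} f1 θ1 f2 θ2) ≈SD combS (coef f1) (derSeq θ1) (coef f2) (derSeq θ2)
  coef-comb e d1 d2 f1 θ1 f2 θ2 m1 m2 = coef-char e _ _ (proj₁ bounds) (λ i → refl) , coef-char e _ _ (proj₂ bounds) (λ i → refl)
    where bounds = combS-deg {δ1 = derSeq θ1} {δ2 = derSeq θ2} m1 m2 (derSeq-deg θ1) (derSeq-deg θ2)

  combS-zero : ∀ {g1 g2} δ1 δ2 → g1 ≈S 0S → g2 ≈S 0S → combS g1 δ1 g2 δ2 ≈SD 0SD
  combS-zero (p1 , q1) (p2 , q2) z1 z2 =
    (λ k → trans (+-cong (⋆-zeroˡ p1 z1 k) (⋆-zeroˡ p2 z2 k)) (+-identityˡ 0#)) ,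
    (λ k → trans (+-cong (⋆-zeroˡ q1 z1 k) (⋆-zeroˡ q2 z2 k)) (+-identityˡ 0#))

  combS-unit : ∀ δ1 δ2 → combS 1S δ1 0S δ2 ≈SD δ1
  combS-unit (p1 , q1) (p2 , q2) =
    (λ k → trans (+-cong (⋆-identityˡ p1 k) (⋆-zeroˡ p2 ≈S-refl k)) (+-identityʳ _)) ,
    (λ k → trans (+-cong (⋆-identityˡ q1 k) (⋆-zeroˡ q2 ≈S-refl k)) (+-identityʳ _))

  combS-swap : ∀ g1 δ1 g2 δ2 → combS g1 δ1 g2 δ2 ≈SD combS g2 δ2 g1 δ1
  combS-swap g1 (p1 , q1) g2 (p2 , q2) = (λ k → +-comm _ _) , (λ k → +-comm _ _)

  Div : ℕ → Lin → ℕ → Seq → Set (c ⊔ ℓ)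
  Div e β m s = Σ Seq λ h → Mult e m h × (s ≈S powS β m ⋆ h)

  Div-resp : ∀ {e β m s t} → s ≈S t → Div e β m s → Div e β m t
  Div-resp st (h , mh , e) = h , mh , ≈S-trans (≈S-sym st) e

  DivBy⇒Div : ∀ {e} β m (p : Form e) → DivBy β m p → Div e β m (coef p)
  DivBy⇒Div {e} β m p (h , sh , eq) = coef h , mh , coef-char e p _ (Mult-⋆' mh (powS-deg β m)) eq
    where mh = Shifted⇒Mult e m h sh

  Div⇒DivBy : ∀ {e} β m (p : Form e) → Div e β m (coef p) → DivBy β m p
  Div⇒DivBy {e} β m p (h , (b , z) , eq) = form (e ∸ m) h , (λ lt → z lt 0) ,
      λ i → trans (reflexive (PE.sym (coef-at e p i)))
              (trans (eq (toℕ i)) (⋆-congˡ (powS β m) (≈S-sym (coef-form (e ∸ m) h b)) (toℕ i)))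

  prodPow : ∀ n → (Fin n → Lin) → (Fin n → ℕ) → Seq
  prodPow zero α κ = 1S
  prodPow (suc n) α κ = powS (α Fin.zero) (κ Fin.zero) ⋆ prodPow n (λ i → α (Fin.suc i)) (λ i → κ (Fin.suc i))

  prodPow-deg : ∀ n α κ → Deg≤ (total κ) (prodPow n α κ)
  prodPow-deg zero α κ = Deg≤-1S
  prodPow-deg (suc n) α κ = Deg≤-⋆ (powS-deg (α Fin.zero) (κ Fin.zero)) (prodPow-deg n _ _)

  ≤-total : ∀ {n} (κ : Fin n → ℕ) H → κ H ≤ total κ
  ≤-total κ Fin.zero = NP.m≤m+n _ _
  ≤-total κ (Fin.suc H) = NP.≤-trans (≤-total (λ i → κ (Fin.suc i)) H) (NP.m≤n+m _ (κ Fin.zero))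

  prodPow-divisible : ∀ n α κ H → Σ Seq λ h → Deg≤ (total κ ∸ κ H) h × (prodPow n α κ ≈S powS (α H) (κ H) ⋆ h)
  prodPow-divisible (suc n) α κ Fin.zero =
    prodPow n _ _ , Deg≤-≡ (PE.sym (NP.m+n∸m≡n (κ Fin.zero) _)) (prodPow-deg n _ _) , ≈S-refl
  prodPow-divisible (suc n) α κ (Fin.suc H) =
    P0 ⋆ h , Deg≤-≡ (PE.sym (NP.+-∸-assoc (κ Fin.zero) (≤-total (λ i → κ (Fin.suc i)) H))) (Deg≤-⋆ (powS-deg (α Fin.zero) (κ Fin.zero)) h-deg) ,
    ≈S-trans (⋆-congˡ P0 eq) (⋆-exchange P0 (powS (α (Fin.suc H)) (κ (Fin.suc H))) h)
    where
    P0 = powS (α Fin.zero) (κ Fin.zero)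
    rest = prodPow-divisible n (λ i → α (Fin.suc i)) (λ i → κ (Fin.suc i)) H
    h = proj₁ rest
    h-deg = proj₁ (proj₂ rest)
    eq = proj₂ (proj₂ rest)

-- Double negation as a monad: cancelling a nonzero linear form needs a case
-- split on whether its coefficients vanish, which equality in K does not decide.
module DoubleNegation where
  DN : ∀ {a} → Set a → Set a
  DN A = ¬ ¬ A

  return : ∀ {a} {A : Set a} → A → DN A
  return a na = na a

  infixl 1 _>>=_
  _>>=_ : ∀ {a b} {A : Set a} {B : Set b} → DN A → (A → DN B) → DN B
  (x >>= f) nb = x (λ a → f a nb)

  excluded-middle : ∀ {a} (A : Set a) → DN (A ⊎ ¬ A)
  excluded-middle A k = k (inj₂ (λ a → k (inj₁ a)))

module Cancellation {c ℓ} (F : Field c ℓ) where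
  open Field F hiding (zero)
  open Over F
  open SequenceRing F
  open FormsAsSequences F
  open DoubleNegation
  open SetoidReasoning setoid
  open NCD commutativeSemiring using (solve; _:=_; _:*_)

  *-cancelˡ : ∀ {x u v} → ¬ (x ≈ 0#) → x * u ≈ x * v → u ≈ v
  *-cancelˡ {x} {u} {v} nz e with inverse x nz
  ... | i , xi≈1 = begin
      u                ≈⟨ sym (*-identityˡ u) ⟩
      1# * u           ≈⟨ *-cong (trans (sym xi≈1) (*-comm x i)) refl ⟩
      (i * x) * u      ≈⟨ *-assoc i x u ⟩
      i * (x * u)      ≈⟨ *-cong refl e ⟩
      i * (x * v)      ≈⟨ sym (*-assoc i x v) ⟩
      (i * x) * v      ≈⟨ *-cong (trans (*-comm i x) xi≈1) refl ⟩
      1# * v           ≈⟨ *-identityˡ v ⟩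
      v ∎

  *-nonzero : ∀ {x y} → ¬ (x ≈ 0#) → ¬ (y ≈ 0#) → ¬ (x * y ≈ 0#)
  *-nonzero {x} nx ny xy = ny (*-cancelˡ nx (trans xy (sym (zeroʳ x))))

  *-zero-cancelʳ : ∀ {x y} → ¬ (y ≈ 0#) → x * y ≈ 0# → x ≈ 0#
  *-zero-cancelʳ {x} {y} ny e = *-cancelˡ ny (trans (*-comm y x) (trans e (sym (zeroʳ y))))

  linS-⋆-suc : ∀ β x k → (linS β ⋆ x) (suc k) ≈ proj₂ β * x (suc k) + proj₁ β * x k
  linS-⋆-suc (a , b) x k = trans (⋆-shift (linS (a , b)) x k) (+-cong refl (begin
      (shiftS (linS (a , b)) ⋆ x) k
    ≈⟨ ⋆-cong {t = x} shift-lin ≈S-refl k ⟩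
      ((a ·S 1S) ⋆ x) k
    ≈⟨ ⋆-scal a 1S x k ⟩
      a * (1S ⋆ x) k
    ≈⟨ *-cong refl (⋆-identityˡ x k) ⟩
      a * x k ∎))
    where
    shift-lin : shiftS (linS (a , b)) ≈S a ·S 1S
    shift-lin zero = sym (*-identityʳ a)
    shift-lin (suc k) = sym (zeroʳ a)

  linS-cancel : ∀ β {x y} → NonZeroLin β → linS β ⋆ x ≈S linS β ⋆ y → DN (x ≈S y)
  linS-cancel (a , b) {x} {y} nz e = excluded-middle (b ≈ 0#) >>= λ
    { (inj₂ b≉0) → return (via-b b≉0)
    ; (inj₁ b≈0) → return (via-a b≈0 (λ a≈0 → nz (a≈0 , b≈0))) }
    where
    open RingProperties ring using (+-cancelʳ)
    -- b ≠ 0: recover the coefficients of x and y from the lowest one upwards.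
    via-b : ¬ (b ≈ 0#) → x ≈S y
    via-b b≉0 zero = *-cancelˡ b≉0 (e zero)
    via-b b≉0 (suc k) = *-cancelˡ b≉0 (+-cancelʳ (a * x k) _ _ (begin
        b * x (suc k) + a * x k   ≈⟨ sym (linS-⋆-suc (a , b) x k) ⟩
        (linS (a , b) ⋆ x) (suc k) ≈⟨ e (suc k) ⟩
        (linS (a , b) ⋆ y) (suc k) ≈⟨ linS-⋆-suc (a , b) y k ⟩
        b * y (suc k) + a * y k   ≈⟨ +-cong refl (*-cong refl (sym (via-b b≉0 k))) ⟩
        b * y (suc k) + a * x k   ∎))
    -- b = 0, a ≠ 0: β ⋆ x is a shifted copy of a x.
    via-a : b ≈ 0# → ¬ (a ≈ 0#) → x ≈S y
    via-a b≈0 a≉0 k = *-cancelˡ a≉0 (begin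
        a * x k                    ≈⟨ sym (+-identityˡ _) ⟩
        0# + a * x k               ≈⟨ +-cong (sym (trans (*-cong b≈0 refl) (zeroˡ _))) refl ⟩
        b * x (suc k) + a * x k    ≈⟨ sym (linS-⋆-suc (a , b) x k) ⟩
        (linS (a , b) ⋆ x) (suc k) ≈⟨ e (suc k) ⟩
        (linS (a , b) ⋆ y) (suc k) ≈⟨ linS-⋆-suc (a , b) y k ⟩
        b * y (suc k) + a * y k    ≈⟨ +-cong (trans (*-cong b≈0 refl) (zeroˡ _)) refl ⟩
        0# + a * y k               ≈⟨ +-identityˡ _ ⟩
        a * y k ∎)

  powS-cancel : ∀ β m {x y} → NonZeroLin β → powS β m ⋆ x ≈S powS β m ⋆ y → DN (x ≈S y)
  powS-cancel β zero {x} {y} nz e = return (λ k → begin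
      x k                   ≈⟨ sym (⋆-identityˡ x k) ⟩
      (1S ⋆ x) k            ≈⟨ ⋆-cong {t = x} (≈S-sym (powS-zero β)) ≈S-refl k ⟩
      (powS β 0 ⋆ x) k      ≈⟨ e k ⟩
      (powS β 0 ⋆ y) k      ≈⟨ ⋆-cong {t = y} (powS-zero β) ≈S-refl k ⟩
      (1S ⋆ y) k            ≈⟨ ⋆-identityˡ y k ⟩
      y k ∎)
  powS-cancel β (suc m) {x} {y} nz e =
    linS-cancel β nz (≈S-trans (≈S-sym (powS-suc-⋆ β m x)) (≈S-trans e (powS-suc-⋆ β m y))) >>= λ e' →
    powS-cancel β m nz e'

  dual-vector : ∀ β → NonZeroLin β → DN (Σ K λ s → Σ K λ t → proj₁ β * s + proj₂ β * t ≈ 1#)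
  dual-vector (a , b) nz = excluded-middle (b ≈ 0#) >>= λ
    { (inj₂ b≉0) → let (j , bj≈1) = inverse b b≉0 in
        return (0# , j , trans (+-cong (zeroʳ a) bj≈1) (+-identityˡ _))
    ; (inj₁ b≈0) → let (i , ai≈1) = inverse a (λ a≈0 → nz (a≈0 , b≈0)) in
        return (i , 0# , trans (+-cong ai≈1 (zeroʳ b)) (+-identityʳ _)) }

  proportional⇒SameLine : ∀ β γ → NonZeroLin β → NonZeroLin γ →
                          proj₂ β * proj₁ γ ≈ proj₁ β * proj₂ γ → DN (SameLine β γ)
  proportional⇒SameLine (a0 , b0) (a , b) nzβ nzγ key = excluded-middle (a0 ≈ 0#) >>= λ
    { (inj₂ a0≉0) → return (via-a0 a0≉0)
    ; (inj₁ a0≈0) → return (via-b0 a0≈0) }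
    where
    nonzero : ∀ {t} → a ≈ t * a0 → b ≈ t * b0 → ¬ (t ≈ 0#)
    nonzero ea eb t≈0 = nzγ (trans ea (trans (*-cong t≈0 refl) (zeroˡ _)) ,
                             trans eb (trans (*-cong t≈0 refl) (zeroˡ _)))
    -- a₀ ≠ 0: the factor is a / a₀.
    via-a0 : ¬ (a0 ≈ 0#) → SameLine (a0 , b0) (a , b)
    via-a0 a0≉0 = t , nonzero ea eb , ea , eb
      where
      i = proj₁ (inverse a0 a0≉0)
      a0i≈1 = proj₂ (inverse a0 a0≉0)
      t = a * i
      ea : a ≈ t * a0
      ea = sym (trans (solve 3 (λ a i a0 → (a :* i) :* a0 := a :* (a0 :* i)) refl a i a0)
                      (trans (*-cong refl a0i≈1) (*-identityʳ a)))
      eb : b ≈ t * b0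
      eb = sym (begin
        (a * i) * b0   ≈⟨ solve 3 (λ a i b0 → (a :* i) :* b0 := i :* (b0 :* a)) refl a i b0 ⟩
        i * (b0 * a)   ≈⟨ *-cong refl key ⟩
        i * (a0 * b)   ≈⟨ solve 3 (λ i a0 b → i :* (a0 :* b) := (a0 :* i) :* b) refl i a0 b ⟩
        (a0 * i) * b   ≈⟨ *-cong a0i≈1 refl ⟩
        1# * b         ≈⟨ *-identityˡ b ⟩
        b ∎)
    -- a₀ = 0: then b₀ ≠ 0, a = 0, and the factor is b / b₀.
    via-b0 : a0 ≈ 0# → SameLine (a0 , b0) (a , b)
    via-b0 a0≈0 = t , nonzero ea eb , ea , eb
      where
      b0≉0 : ¬ (b0 ≈ 0#)
      b0≉0 b0≈0 = nzβ (a0≈0 , b0≈0)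
      j = proj₁ (inverse b0 b0≉0)
      t = b * j
      a≈0 : a ≈ 0#
      a≈0 = *-cancelˡ b0≉0 (trans key (trans (*-cong a0≈0 refl) (trans (zeroˡ b) (sym (zeroʳ b0)))))
      ea : a ≈ t * a0
      ea = trans a≈0 (sym (trans (*-cong refl a0≈0) (zeroʳ t)))
      eb : b ≈ t * b0
      eb = sym (trans (*-assoc b j b0) (trans (*-cong refl (trans (*-comm j b0) (proj₂ (inverse b0 b0≉0)))) (*-identityʳ b)))

-- Evaluating a form of degree d at a point (px, py) of K² is multiplicative.
-- A point on the line of H₀ but on no other line detects that an element is
-- not a multiple of α₀.
module Evaluation {c ℓ} (F : Field c ℓ) (px py : Field.Carrier F) where
  open Field F hiding (zero)
  open Over F
  open SequenceRing F
  open FormsAsSequences F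
  open Cancellation F using (*-nonzero)
  open SetoidReasoning setoid
  open NCD commutativeSemiring using (solve; _:=_; _:+_; _:*_)

  power : K → ℕ → K
  power x zero = 1#
  power x (suc m) = x * power x m

  power-+ : ∀ x m n → power x (m ℕ.+ n) ≈ power x m * power x n
  power-+ x zero n = sym (*-identityˡ _)
  power-+ x (suc m) n = trans (*-cong refl (power-+ x m n)) (sym (*-assoc _ _ _))

  power-nonzero : ∀ x m → ¬ (x ≈ 0#) → ¬ (power x m ≈ 0#)
  power-nonzero x zero x≉0 e = 0≉1 (sym e)
  power-nonzero x (suc m) x≉0 = *-nonzero x≉0 (power-nonzero x m x≉0)

  pw : ℕ → K
  pw = power py

  -- eval s d = Σ_{k ≤ d} s_k px^k py^(d−k), by Horner's scheme in px.
  eval : Seq → ℕ → K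
  eval s zero = s 0
  eval s (suc d) = s 0 * pw (suc d) + px * eval (shiftS s) d

  eval-cong : ∀ {s t} d → s ≈S t → eval s d ≈ eval t d
  eval-cong zero e = e 0
  eval-cong (suc d) e = +-cong (*-cong (e 0) refl) (*-cong refl (eval-cong d (λ k → e (suc k))))

  eval-zero : ∀ {s} d → s ≈S 0S → eval s d ≈ 0#
  eval-zero zero z = z 0
  eval-zero (suc d) z = trans (+-cong (trans (*-cong (z 0) refl) (zeroˡ _))
                                      (trans (*-cong refl (eval-zero d (λ k → z (suc k)))) (zeroʳ _))) (+-identityˡ 0#)

  eval-+ : ∀ s t d → eval (s +S t) d ≈ eval s d + eval t d
  eval-+ s t zero = refl
  eval-+ s t (suc d) = begin
      (s 0 + t 0) * P + px * eval (shiftS s +S shiftS t) d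
    ≈⟨ +-cong refl (*-cong refl (eval-+ (shiftS s) (shiftS t) d)) ⟩
      (s 0 + t 0) * P + px * (eval (shiftS s) d + eval (shiftS t) d)
    ≈⟨ solve 6 (λ a b P x u v → (a :+ b) :* P :+ x :* (u :+ v) := (a :* P :+ x :* u) :+ (b :* P :+ x :* v)) refl
         (s 0) (t 0) P px (eval (shiftS s) d) (eval (shiftS t) d) ⟩
      (s 0 * P + px * eval (shiftS s) d) + (t 0 * P + px * eval (shiftS t) d) ∎
    where P = pw (suc d)

  eval-· : ∀ a s d → eval (a ·S s) d ≈ a * eval s d
  eval-· a s zero = refl
  eval-· a s (suc d) = begin
      (a * s 0) * P + px * eval (a ·S shiftS s) d
    ≈⟨ +-cong refl (*-cong refl (eval-· a (shiftS s) d)) ⟩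
      (a * s 0) * P + px * (a * eval (shiftS s) d)
    ≈⟨ solve 5 (λ a b P x u → (a :* b) :* P :+ x :* (a :* u) := a :* (b :* P :+ x :* u)) refl a (s 0) P px (eval (shiftS s) d) ⟩
      a * (s 0 * P + px * eval (shiftS s) d) ∎
    where P = pw (suc d)

  shift-deg : ∀ {b s} → Deg≤ (suc b) s → Deg≤ b (shiftS s)
  shift-deg bs k lt = bs (suc k) (s≤s lt)

  eval-lift : ∀ b {t} → Deg≤ b t → ∀ k → eval t (k ℕ.+ b) ≈ pw k * eval t b
  eval-lift zero {t} bt k = begin
      eval t (k ℕ.+ 0)  ≈⟨ reflexive (PE.cong (eval t) (NP.+-identityʳ k)) ⟩
      eval t k          ≈⟨ eval-const k ⟩
      t 0 * pw k        ≈⟨ *-comm _ _ ⟩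
      pw k * t 0 ∎
    where
    eval-const : ∀ k → eval t k ≈ t 0 * pw k
    eval-const zero = sym (*-identityʳ _)
    eval-const (suc k) = trans (+-cong refl (trans (*-cong refl (eval-zero k (const-shift bt))) (zeroʳ _))) (+-identityʳ _)
  eval-lift (suc b) {t} bt k = begin
      eval t (k ℕ.+ suc b)
    ≈⟨ reflexive (PE.cong (eval t) (NP.+-suc k b)) ⟩
      t 0 * pw (suc (k ℕ.+ b)) + px * eval (shiftS t) (k ℕ.+ b)
    ≈⟨ +-cong (*-cong refl (trans (reflexive (PE.cong (λ m → pw (suc m)) (NP.+-comm k b))) (power-+ py (suc b) k)))
              (*-cong refl (eval-lift b (shift-deg bt) k)) ⟩
      t 0 * (pw (suc b) * pw k) + px * (pw k * eval (shiftS t) b)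
    ≈⟨ solve 5 (λ a P Q x u → a :* (P :* Q) :+ x :* (Q :* u) := Q :* (a :* P :+ x :* u)) refl (t 0) (pw (suc b)) (pw k) px (eval (shiftS t) b) ⟩
      pw k * (t 0 * pw (suc b) + px * eval (shiftS t) b) ∎

  eval-⋆ : ∀ a b {s t} → Deg≤ a s → Deg≤ b t → eval (s ⋆ t) (a ℕ.+ b) ≈ eval s a * eval t b
  eval-⋆ zero b {s} {t} bs bt = trans (eval-cong b (const-⋆ t bs)) (eval-· (s 0) t b)
  eval-⋆ (suc a) b {s} {t} bs bt = begin
      (s 0 * t 0) * P + px * eval (shiftS (s ⋆ t)) (a ℕ.+ b)
    ≈⟨ +-cong refl (*-cong refl (trans (eval-cong (a ℕ.+ b) (⋆-shift s t)) (eval-+ _ _ (a ℕ.+ b)))) ⟩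
      (s 0 * t 0) * P + px * (eval (s 0 ·S shiftS t) (a ℕ.+ b) + eval (shiftS s ⋆ t) (a ℕ.+ b))
    ≈⟨ +-cong refl (*-cong refl (+-cong (eval-· (s 0) (shiftS t) (a ℕ.+ b)) (eval-⋆ a b (shift-deg bs) bt))) ⟩
      (s 0 * t 0) * P + px * (s 0 * E' + Es * Et)
    ≈⟨ solve 7 (λ s0 t0 P x E' Es Et → (s0 :* t0) :* P :+ x :* (s0 :* E' :+ Es :* Et) := s0 :* (t0 :* P :+ x :* E') :+ x :* Es :* Et) refl
         (s 0) (t 0) P px E' Es Et ⟩
      s 0 * eval t (suc a ℕ.+ b) + px * Es * Et
    ≈⟨ +-cong (*-cong refl (eval-lift b bt (suc a))) refl ⟩
      s 0 * (pw (suc a) * Et) + px * Es * Et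
    ≈⟨ solve 5 (λ s0 Q x Es Et → s0 :* (Q :* Et) :+ x :* Es :* Et := (s0 :* Q :+ x :* Es) :* Et) refl (s 0) (pw (suc a)) px Es Et ⟩
      (s 0 * pw (suc a) + px * Es) * Et ∎
    where
    P = pw (suc (a ℕ.+ b))
    E' = eval (shiftS t) (a ℕ.+ b)
    Es = eval (shiftS s) a
    Et = eval t b

  eval-linS : ∀ β → eval (linS β) 1 ≈ proj₁ β * px + proj₂ β * py
  eval-linS (a , b) = trans (+-comm _ _) (+-cong (*-comm px a) (*-cong refl (*-identityʳ py)))

  eval-powS : ∀ β m → eval (powS β m) m ≈ power (eval (linS β) 1) m
  eval-powS β zero = refl
  eval-powS β (suc m) = trans (eval-cong (suc m) (powS-suc β m))
    (trans (eval-⋆ 1 m (linS-deg β) (powS-deg β m)) (*-cong refl (eval-powS β m)))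

  prodPow-nonzero : ∀ n α κ → (∀ H → κ H ≡ 0 ⊎ ¬ (eval (linS (α H)) 1 ≈ 0#)) →
                    ¬ (eval (prodPow n α κ) (total κ) ≈ 0#)
  prodPow-nonzero zero α κ _ e = 0≉1 (sym e)
  prodPow-nonzero (suc n) α κ hyp e =
    *-nonzero (first (hyp Fin.zero)) (prodPow-nonzero n _ _ (λ H → hyp (Fin.suc H)))
      (trans (sym (eval-⋆ (κ Fin.zero) (total (λ i → κ (Fin.suc i))) (powS-deg (α Fin.zero) (κ Fin.zero)) (prodPow-deg n _ _))) e)
    where
    first : κ Fin.zero ≡ 0 ⊎ ¬ (eval (linS (α Fin.zero)) 1 ≈ 0#) → ¬ (eval (powS (α Fin.zero) (κ Fin.zero)) (κ Fin.zero) ≈ 0#)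
    first (inj₁ κ0≡0) e' rewrite κ0≡0 = 0≉1 (sym e')
    first (inj₂ nz) e' = power-nonzero _ (κ Fin.zero) nz (trans (sym (eval-powS (α Fin.zero) (κ Fin.zero))) e')

module DerivationAlgebra {c ℓ} (F : Field c ℓ) where
  open Field F hiding (zero)
  open Over F
  open SequenceRing F
  open FormsAsSequences F
  open DoubleNegation
  open SeqSolver using (solve; _:=_; _:+_; _:*_)

  ·S-as-⋆ : ∀ x s → x ·S s ≈S (x ·S 1S) ⋆ s
  ·S-as-⋆ x s k = sym (trans (⋆-scal x 1S s k) (*-cong refl (⋆-identityˡ s k)))

  applyS-as-⋆ : ∀ δ β → applyS δ β ≈S (proj₁ β ·S 1S) ⋆ proj₁ δ +S (proj₂ β ·S 1S) ⋆ proj₂ δ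
  applyS-as-⋆ (f , g) (a , b) = +S-cong (·S-as-⋆ a f) (·S-as-⋆ b g)

  applyS-comb : ∀ g1 δ1 g2 δ2 β → applyS (combS g1 δ1 g2 δ2) β ≈S g1 ⋆ applyS δ1 β +S g2 ⋆ applyS δ2 β
  applyS-comb g1 (p1 , q1) g2 (p2 , q2) (a , b) = ≈S-trans (applyS-as-⋆ (combS g1 (p1 , q1) g2 (p2 , q2)) (a , b))
     (≈S-trans (solve 8 (λ A B g1 g2 p1 q1 p2 q2 → A :* (g1 :* p1 :+ g2 :* p2) :+ B :* (g1 :* q1 :+ g2 :* q2)
                  := g1 :* (A :* p1 :+ B :* q1) :+ g2 :* (A :* p2 :+ B :* q2)) ≈S-refl (a ·S 1S) (b ·S 1S) g1 g2 p1 q1 p2 q2)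
        (+S-cong (⋆-congˡ g1 (≈S-sym (applyS-as-⋆ (p1 , q1) (a , b)))) (⋆-congˡ g2 (≈S-sym (applyS-as-⋆ (p2 , q2) (a , b))))))

  linD : Lin → SDer → SDer
  linD l (f , g) = linS l ⋆ f , linS l ⋆ g

  linD-deg : ∀ {d δ} l → DerDeg≤ d δ → DerDeg≤ (suc d) (linD l δ)
  linD-deg l (b1 , b2) = Deg≤-⋆ (linS-deg l) b1 , Deg≤-⋆ (linS-deg l) b2

  applyS-linD : ∀ l δ β → applyS (linD l δ) β ≈S linS l ⋆ applyS δ β
  applyS-linD l (f , g) (a , b) = ≈S-trans (applyS-as-⋆ (linD l (f , g)) (a , b))
     (≈S-trans (solve 5 (λ A B L f g → A :* (L :* f) :+ B :* (L :* g) := L :* (A :* f :+ B :* g)) ≈S-refl (a ·S 1S) (b ·S 1S) (linS l) f g)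
        (⋆-congˡ (linS l) (≈S-sym (applyS-as-⋆ (f , g) (a , b)))))

  combS-linD : ∀ l g1 δ1 g2 δ2 → combS g1 (linD l δ1) g2 (linD l δ2) ≈SD linD l (combS g1 δ1 g2 δ2)
  combS-linD l g1 (p1 , q1) g2 (p2 , q2) = pull p1 p2 , pull q1 q2
    where
    pull : ∀ p1 p2 → g1 ⋆ (linS l ⋆ p1) +S g2 ⋆ (linS l ⋆ p2) ≈S linS l ⋆ (g1 ⋆ p1 +S g2 ⋆ p2)
    pull = solve 5 (λ L g1 g2 p1 p2 → g1 :* (L :* p1) :+ g2 :* (L :* p2) := L :* (g1 :* p1 :+ g2 :* p2)) ≈S-refl (linS l) g1 g2

  Div-comb : ∀ {a1 a2 k β m s1 s2 g1 g2} → Div a1 β m s1 → Div a2 β m s2 → Mult k a1 g1 → Mult k a2 g2 →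
             Div k β m (g1 ⋆ s1 +S g2 ⋆ s2)
  Div-comb {a1} {a2} {k} {β} {m} {s1} {s2} {g1} {g2} (h1 , mh1 , eq1) (h2 , mh2 , eq2) mg1 mg2 =
    g1 ⋆ h1 +S g2 ⋆ h2 , Mult-+ (Mult-⋆-Mult mg1 mh1) (Mult-⋆-Mult mg2 mh2) ,
    ≈S-trans (+S-cong (⋆-congˡ g1 eq1) (⋆-congˡ g2 eq2))
      (solve 5 (λ P g1 h1 g2 h2 → g1 :* (P :* h1) :+ g2 :* (P :* h2) := P :* (g1 :* h1 :+ g2 :* h2)) ≈S-refl (powS β m) g1 h1 g2 h2)

  Div-linS : ∀ {d β m s} l → Div d β m s → Div (suc d) β m (linS l ⋆ s)
  Div-linS {d} {β} {m} {s} l (h , (bh , zh) , eq) =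
    linS l ⋆ h , Mult-⋆-linS ,
    ≈S-trans (⋆-congˡ (linS l) eq) (⋆-exchange (linS l) (powS β m) h)
    where
    Mult-⋆-linS : Mult (suc d) m (linS l ⋆ h)
    Mult-⋆-linS with d NP.<? m
    ... | yes lt = Deg≤-zero (⋆-zeroʳ (linS l) (zh lt)) , λ _ → ⋆-zeroʳ (linS l) (zh lt)
    ... | no d≮m = Deg≤-≡ (PE.sym (NP.+-∸-assoc 1 (NP.≮⇒≥ d≮m))) (Deg≤-⋆ (linS-deg l) bh) ,
                   λ lt → ⊥-elim (d≮m (NP.<-trans (NP.n<1+n d) lt))

  Div-linS-same : ∀ {d β m s} → Div d β m s → Div (suc d) β (suc m) (linS β ⋆ s)
  Div-linS-same {d} {β} {m} {s} (h , (bh , zh) , eq) = h , (bh , λ lt → zh (NP.≤-pred lt)) ,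
    ≈S-trans (⋆-congˡ (linS β) eq) (≈S-sym (powS-suc-⋆ β m h))

  Div-lower : ∀ {e β m s} → Div e β (suc m) s → Div e β m s
  Div-lower {e} {β} {m} {s} (h , (bh , zh) , eq) =
    linS β ⋆ h , cofactor ,
    ≈S-trans eq (≈S-trans (powS-suc-⋆ β m h) (⋆-exchange (linS β) (powS β m) h))
    where
    cofactor : Mult e m (linS β ⋆ h)
    cofactor with e NP.<? suc m
    ... | yes lt = Deg≤-zero (⋆-zeroʳ (linS β) (zh lt)) , λ _ → ⋆-zeroʳ (linS β) (zh lt)
    ... | no e≮1+m = Deg≤-≡ (PE.sym (NP.+-∸-assoc 1 (NP.≮⇒≥ e≮1+m))) (Deg≤-⋆ (linS-deg β) bh) ,
                     λ lt → ⊥-elim (e≮1+m (NP.<-trans lt (NP.n<1+n m)))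

  Independent : ℕ → ℕ → SDer → SDer → Set (c ⊔ ℓ)
  Independent e1 e2 ξ1 ξ2 = ∀ e g1 g2 → Mult e e1 g1 → Mult e e2 g2 → combS g1 ξ1 g2 ξ2 ≈SD 0SD →
                            DN ((g1 ≈S 0S) × (g2 ≈S 0S))

  independent-nonzero : ∀ {e1 e2 ξ1 ξ2} → Independent e1 e2 ξ1 ξ2 → ¬ (ξ1 ≈SD 0SD)
  independent-nonzero {e1} {e2} {ξ1} {ξ2} ind z =
    ind e1 1S 0S (Mult-const Deg≤-1S) (Mult-0S e1 e2) (≈SD-trans (combS-unit ξ1 ξ2) z) (λ (o , _) → 0≉1 (sym (o 0)))

  applyS-· : ∀ x y Z β → applyS (x ·S Z , y ·S Z) β ≈S (proj₁ β * x + proj₂ β * y) ·S Z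
  applyS-· x y Z (a , b) k = trans (+-cong (sym (*-assoc a x (Z k))) (sym (*-assoc b y (Z k)))) (sym (distribʳ _ _ _))

  Div-· : ∀ {e β m Z h} x → Z ≈S powS β m ⋆ h → Deg≤ (e ∸ m) h → m ≤ e → Div e β m (x ·S Z)
  Div-· {e} {β} {m} {Z} {h} x eq b m≤e = x ·S h , (Deg≤-· x b , λ lt → ⊥-elim (NP.<⇒≱ lt m≤e)) ,
    λ k → trans (*-cong refl (trans (eq k) (⋆-comm (powS β m) h k)))
                (trans (sym (⋆-scal x h (powS β m) k)) (⋆-comm (x ·S h) (powS β m) k))

module Derivations {c ℓ} (F : Field c ℓ) {n : ℕ} (α : Fin n → Over.Lin F) where
  open Field F hiding (zero)
  open Over F
  open SequenceRing F
  open FormsAsSequences F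
  open DerivationAlgebra F
  open DoubleNegation
  open RingProperties ring using (-0#≈0#; -‿injective)

  InDS : (Fin n → ℕ) → ℕ → SDer → Set (c ⊔ ℓ)
  InDS κ e δ = ∀ H → Div e (α H) (κ H) (applyS δ (α H))

  InDS-resp : ∀ {κ e δ δ'} → δ ≈SD δ' → InDS κ e δ → InDS κ e δ'
  InDS-resp {δ = f , g} (e1 , e2) m H = Div-resp (+S-cong (λ k → *-cong refl (e1 k)) (λ k → *-cong refl (e2 k))) (m H)

  InDS-comb : ∀ {κ a1 a2 k ξ1 ξ2 g1 g2} → InDS κ a1 ξ1 → InDS κ a2 ξ2 → Mult k a1 g1 → Mult k a2 g2 →
              InDS κ k (combS g1 ξ1 g2 ξ2)
  InDS-comb {ξ1 = ξ1} {ξ2} {g1} {g2} m1 m2 c1 c2 H =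
    Div-resp (≈S-sym (applyS-comb g1 ξ1 g2 ξ2 (α H))) (Div-comb (m1 H) (m2 H) c1 c2)

  InD⇒InDS : ∀ κ {d} (θ : Der d) → InD α κ θ → InDS κ d (derSeq θ)
  InD⇒InDS κ θ m H = Div-resp (coef-apply θ (α H)) (DivBy⇒Div (α H) (κ H) _ (m H))

  InDS⇒InD : ∀ κ {d} (θ : Der d) → InDS κ d (derSeq θ) → InD α κ θ
  InDS⇒InD κ θ m H = Div⇒DivBy (α H) (κ H) _ (Div-resp (≈S-sym (coef-apply θ (α H))) (m H))

  record SeqBasis (κ : Fin n → ℕ) (d1 d2 : ℕ) (θ1 θ2 : SDer) : Set (c ⊔ ℓ) where
    field
      deg1 : DerDeg≤ d1 θ1
      deg2 : DerDeg≤ d2 θ2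
      mem1 : InDS κ d1 θ1
      mem2 : InDS κ d2 θ2
      spans : ∀ e δ → DerDeg≤ e δ → InDS κ e δ →
        Σ Seq λ g1 → Σ Seq λ g2 → Mult e d1 g1 × Mult e d2 g2 × (δ ≈SD combS g1 θ1 g2 θ2)
      indep : ∀ e g1 g2 → Mult e d1 g1 → Mult e d2 g2 → combS g1 θ1 g2 θ2 ≈SD 0SD →
        (g1 ≈S 0S) × (g2 ≈S 0S)

  independent : ∀ {κ d1 d2 θ1 θ2} → SeqBasis κ d1 d2 θ1 θ2 → Independent d1 d2 θ1 θ2
  independent B e g1 g2 c1 c2 z = return (SeqBasis.indep B e g1 g2 c1 c2 z)

  swapBasis : ∀ {κ d1 d2 θ1 θ2} → SeqBasis κ d1 d2 θ1 θ2 → SeqBasis κ d2 d1 θ2 θ1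
  swapBasis {θ1 = θ1} {θ2} B = record
    { deg1 = SeqBasis.deg2 B ; deg2 = SeqBasis.deg1 B ; mem1 = SeqBasis.mem2 B ; mem2 = SeqBasis.mem1 B
    ; spans = λ e δ b m → case SeqBasis.spans B e δ b m of λ
        { (g1 , g2 , c1 , c2 , eq) → g2 , g1 , c2 , c1 , ≈SD-trans eq (combS-swap g1 θ1 g2 θ2) }
    ; indep = λ e g1 g2 c1 c2 z → case SeqBasis.indep B e g2 g1 c2 c1 (≈SD-trans (combS-swap g2 θ1 g1 θ2) z) of λ
        { (z2 , z1) → z1 , z2 } }

  module FromHomBasis {κ d1 d2} {θ1 : Der d1} {θ2 : Der d2} (B : HomBasis α κ d1 d2 θ1 θ2) where
    spans : ∀ e δ → DerDeg≤ e δ → InDS κ e δ →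
      Σ Seq λ g1 → Σ Seq λ g2 → Mult e d1 g1 × Mult e d2 g2 × (δ ≈SD combS g1 (derSeq θ1) g2 (derSeq θ2))
    spans e (δx , δy) (bx , by) m = coef f1 , coef f2 , c1 , c2 ,
        ≈S-trans (≈S-sym (coef-form e δx bx)) (≈S-trans (coef-cong e _ _ ex) (proj₁ cc)) ,
        ≈S-trans (≈S-sym (coef-form e δy by)) (≈S-trans (coef-cong e _ _ ey) (proj₂ cc))
      where
      δF : Der e
      δF = form e δx , form e δy
      expansion = HomBasis.spans B e δF
        (InDS⇒InD κ δF (InDS-resp (≈S-sym (coef-form e δx bx) , ≈S-sym (coef-form e δy by)) m))
      f1 = proj₁ expansion
      f2 = proj₁ (proj₂ expansion)
      c1 = Shifted⇒Mult e d1 f1 (proj₁ (proj₂ (proj₂ expansion)))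
      c2 = Shifted⇒Mult e d2 f2 (proj₁ (proj₂ (proj₂ (proj₂ expansion))))
      ex = proj₁ (proj₂ (proj₂ (proj₂ (proj₂ expansion))))
      ey = proj₂ (proj₂ (proj₂ (proj₂ (proj₂ expansion))))
      cc = coef-comb e d1 d2 f1 θ1 f2 θ2 c1 c2

    indep : ∀ e g1 g2 → Mult e d1 g1 → Mult e d2 g2 → combS g1 (derSeq θ1) g2 (derSeq θ2) ≈SD 0SD →
      (g1 ≈S 0S) × (g2 ≈S 0S)
    indep e g1 g2 (b1 , z1) (b2 , z2) (zx , zy) = form-zero g1 b1 (proj₁ r) , form-zero g2 b2 (proj₂ r)
      where
      F1 = form (e ∸ d1) g1
      F2 = form (e ∸ d2) g2
      e1 = coef-form (e ∸ d1) g1 b1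
      e2 = coef-form (e ∸ d2) g2 b2
      c1 : Mult e d1 (coef F1)
      c1 = Deg≤-resp (≈S-sym e1) b1 , λ lt → ≈S-trans e1 (z1 lt)
      c2 : Mult e d2 (coef F2)
      c2 = Deg≤-resp (≈S-sym e2) b2 , λ lt → ≈S-trans e2 (z2 lt)
      cc = coef-comb e d1 d2 F1 θ1 F2 θ2 c1 c2
      zx' = ≈S-trans (+S-cong (⋆-cong {t = coef (proj₁ θ1)} e1 ≈S-refl) (⋆-cong {t = coef (proj₁ θ2)} e2 ≈S-refl)) zx
      zy' = ≈S-trans (+S-cong (⋆-cong {t = coef (proj₂ θ1)} e1 ≈S-refl) (⋆-cong {t = coef (proj₂ θ2)} e2 ≈S-refl)) zy
      r = HomBasis.indep B e F1 F2 (λ lt → z1 lt 0) (λ lt → z2 lt 0)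
            ((λ i → trans (reflexive (PE.sym (coef-at e _ i))) (trans (proj₁ cc (toℕ i)) (zx' (toℕ i)))) ,
             (λ i → trans (reflexive (PE.sym (coef-at e _ i))) (trans (proj₂ cc (toℕ i)) (zy' (toℕ i)))))
      form-zero : ∀ {d} g → Deg≤ d g → form d g ≈F zeroF → g ≈S 0S
      form-zero {d} g b z = ≈S-trans (≈S-sym (coef-form d g b))
        (≈S-trans (coef-cong d _ zeroF z) (coef-char d zeroF 0S (Deg≤-zero ≈S-refl) (λ i → refl)))

  toSeqBasis : ∀ {κ d1 d2} {θ1 : Der d1} {θ2 : Der d2} → HomBasis α κ d1 d2 θ1 θ2 →
               SeqBasis κ d1 d2 (derSeq θ1) (derSeq θ2)
  toSeqBasis {κ} {θ1 = θ1} {θ2} B = record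
    { deg1 = derSeq-deg θ1 ; deg2 = derSeq-deg θ2
    ; mem1 = InD⇒InDS κ θ1 (HomBasis.mem₁ B) ; mem2 = InD⇒InDS κ θ2 (HomBasis.mem₂ B)
    ; spans = FromHomBasis.spans B ; indep = FromHomBasis.indep B }

  negS-zero : ∀ {f} → negS f ≈S 0S → f ≈S 0S
  negS-zero z k = -‿injective (trans (z k) (sym -0#≈0#))

  combS-drop₂ : ∀ {g1 g2} δ1 δ2 → g2 ≈S 0S → combS g1 δ1 g2 δ2 ≈SD (g1 ⋆ proj₁ δ1 , g1 ⋆ proj₂ δ1)
  combS-drop₂ {g1} (p1 , q1) (p2 , q2) z =
    (λ k → trans (+-cong refl (⋆-zeroˡ p2 z k)) (+-identityʳ _)) ,
    (λ k → trans (+-cong refl (⋆-zeroˡ q2 z k)) (+-identityʳ _))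

  module _ {κ d1 d2 θ1 θ2} (B : SeqBasis κ d1 d2 θ1 θ2) (d1≤d2 : d1 ≤ d2) where
    open TwoByTwo seqRing using (multiples-dependent)

    below-basis-zero : ∀ e δ → DerDeg≤ e δ → InDS κ e δ → e < d1 → δ ≈SD 0SD
    below-basis-zero e δ b m e<d1 = ≈SD-trans eq (combS-zero θ1 θ2 (z1 e<d1) (z2 (NP.<-≤-trans e<d1 d1≤d2)))
      where
      expansion = SeqBasis.spans B e δ b m
      z1 = proj₂ (proj₁ (proj₂ (proj₂ expansion)))
      z2 = proj₂ (proj₁ (proj₂ (proj₂ (proj₂ expansion))))
      eq = proj₂ (proj₂ (proj₂ (proj₂ expansion)))

    -- Below d₂ every element is a multiple of θ₁, so an independent pair
    -- ξ₁, ξ₂ has its larger degree e₂ at least d₂: otherwise f₂ ξ₁ − f₁ ξ₂ = 0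
    -- for ξᵢ = fᵢ θ₁.
    second-degree-bound : ∀ {e1 e2 ξ1 ξ2} → d1 ≤ e1 → e1 ≤ e2 → DerDeg≤ e1 ξ1 → DerDeg≤ e2 ξ2 →
                          InDS κ e1 ξ1 → InDS κ e2 ξ2 → Independent e1 e2 ξ1 ξ2 → ¬ (e2 < d2)
    second-degree-bound {e1} {e2} {ξ1} {ξ2} d1≤e1 e1≤e2 b1 b2 m1 m2 ind e2<d2 =
      ind E f2 (negS f1) mf2 mf1 relation λ (_ , zf1) →
        independent-nonzero {ξ2 = ξ2} ind (≈SD-trans ξ1≈ (combS-zero θ1 θ2 (negS-zero zf1) zg1))
      where
      exp1 = SeqBasis.spans B e1 ξ1 b1 m1
      exp2 = SeqBasis.spans B e2 ξ2 b2 m2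
      f1 = proj₁ exp1
      f2 = proj₁ exp2
      ξ1≈ = proj₂ (proj₂ (proj₂ (proj₂ exp1)))
      ξ2≈ = proj₂ (proj₂ (proj₂ (proj₂ exp2)))
      zg1 = proj₂ (proj₁ (proj₂ (proj₂ (proj₂ exp1)))) (NP.≤-<-trans e1≤e2 e2<d2)
      zg2 = proj₂ (proj₁ (proj₂ (proj₂ (proj₂ exp2)))) e2<d2
      ξ1≈f1θ1 = ≈SD-trans ξ1≈ (combS-drop₂ θ1 θ2 zg1)
      ξ2≈f2θ1 = ≈SD-trans ξ2≈ (combS-drop₂ θ1 θ2 zg2)
      -- The relation lives in degree E = e₁ + e₂ − d₁.
      E = e1 ℕ.+ (e2 ∸ d1)
      mf2 : Mult E e1 f2
      mf2 = Deg≤-≡ (PE.sym (NP.m+n∸m≡n e1 (e2 ∸ d1))) (proj₁ (proj₁ (proj₂ (proj₂ exp2)))) ,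
            λ lt → ⊥-elim (NP.<⇒≱ lt (NP.m≤m+n e1 _))
      E∸e2 : E ∸ e2 ≡ e1 ∸ d1
      E∸e2 = PE.trans (PE.cong (_∸ e2) (PE.trans (PE.sym (NP.+-∸-assoc e1 (NP.≤-trans d1≤e1 e1≤e2))) (NP.+-∸-comm e2 d1≤e1)))
                      (NP.m+n∸n≡m (e1 ∸ d1) e2)
      e2≤E : e2 ≤ E
      e2≤E = PE.subst (_≤ E) (NP.m+[n∸m]≡n (NP.≤-trans d1≤e1 e1≤e2)) (NP.+-monoˡ-≤ (e2 ∸ d1) d1≤e1)
      mf1 : Mult E e2 (negS f1)
      mf1 = Deg≤-≡ (PE.sym E∸e2) (Deg≤-neg (proj₁ (proj₁ (proj₂ (proj₂ exp1))))) , λ lt → ⊥-elim (NP.<⇒≱ lt e2≤E)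
      relation : combS f2 ξ1 (negS f1) ξ2 ≈SD 0SD
      relation = multiples-dependent f1 f2 (proj₁ θ1) (proj₁ ξ1) (proj₁ ξ2) (proj₁ ξ1≈f1θ1) (proj₁ ξ2≈f2θ1) ,
                 multiples-dependent f1 f2 (proj₂ θ1) (proj₂ ξ1) (proj₂ ξ2) (proj₂ ξ1≈f1θ1) (proj₂ ξ2≈f2θ1)

    independent-degrees : ∀ {e1 e2 ξ1 ξ2} → e1 ≤ e2 → DerDeg≤ e1 ξ1 → DerDeg≤ e2 ξ2 →
                          InDS κ e1 ξ1 → InDS κ e2 ξ2 → Independent e1 e2 ξ1 ξ2 → (d1 ≤ e1) × (d2 ≤ e2)
    independent-degrees {e1} {e2} {ξ1} {ξ2} e1≤e2 b1 b2 m1 m2 ind = d1≤e1 , d2≤e2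
      where
      d1≤e1 : d1 ≤ e1
      d1≤e1 = NP.≮⇒≥ λ e1<d1 → independent-nonzero {ξ2 = ξ2} ind (below-basis-zero e1 ξ1 b1 m1 e1<d1)
      d2≤e2 : d2 ≤ e2
      d2≤e2 = NP.≮⇒≥ (second-degree-bound {ξ1 = ξ1} {ξ2} d1≤e1 e1≤e2 b1 b2 m1 m2 ind)

  -- Writing ξᵢ = mᵢ₁ θ₁ + mᵢ₂ θ₂, the transition
  -- matrix has constant determinant; it is nonzero since otherwise the adjugate
  -- gives a relation between ξ₁ and ξ₂, so Cramer's rule expresses θ₁, θ₂,
  -- and hence everything, through ξ₁, ξ₂.
  module SameDegrees {κ a1 a2 θ1 θ2} (B : SeqBasis κ a1 a2 θ1 θ2)
                     {ξ1 ξ2} (b1 : DerDeg≤ a1 ξ1) (b2 : DerDeg≤ a2 ξ2)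
                     (mξ1 : InDS κ a1 ξ1) (mξ2 : InDS κ a2 ξ2) (ind : Independent a1 a2 ξ1 ξ2) where
    open TwoByTwo seqRing using (det; adjugate₁; adjugate₂; cramer)

    row1 = SeqBasis.spans B a1 ξ1 b1 mξ1
    row2 = SeqBasis.spans B a2 ξ2 b2 mξ2
    m11 = proj₁ row1
    m12 = proj₁ (proj₂ row1)
    m21 = proj₁ row2
    m22 = proj₁ (proj₂ row2)
    m11-mult : Mult a1 a1 m11
    m11-mult = proj₁ (proj₂ (proj₂ row1))
    m12-mult : Mult a1 a2 m12
    m12-mult = proj₁ (proj₂ (proj₂ (proj₂ row1)))
    m21-mult : Mult a2 a1 m21
    m21-mult = proj₁ (proj₂ (proj₂ row2))
    m22-mult : Mult a2 a2 m22
    m22-mult = proj₁ (proj₂ (proj₂ (proj₂ row2)))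
    ξ1≈ : ξ1 ≈SD combS m11 θ1 m12 θ2
    ξ1≈ = proj₂ (proj₂ (proj₂ (proj₂ row1)))
    ξ2≈ : ξ2 ≈SD combS m21 θ1 m22 θ2
    ξ2≈ = proj₂ (proj₂ (proj₂ (proj₂ row2)))

    m11-const = Mult-const⁻¹ m11-mult
    m22-const = Mult-const⁻¹ m22-mult

    D : Seq
    D = det m11 m12 m21 m22

    D-const : Deg≤ 0 D
    D-const = Deg≤-+ (Deg≤-⋆ m11-const m22-const) (Mult-const⁻¹ (Mult-⋆-Mult (Mult-neg m12-mult) m21-mult))

    -- det = 0 would give the relations m₂₂ ξ₁ − m₁₂ ξ₂ = 0 and −m₂₁ ξ₁ + m₁₁ ξ₂ = 0,
    -- so all mᵢⱼ vanish by independence, and then ξ₁ = 0.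
    D-nonzero : ¬ (D 0 ≈ 0#)
    D-nonzero D0≈0 =
      ind a1 m22 (negS m12) (Mult-const m22-const) (Mult-neg m12-mult) relation₁ λ (z22 , z12) →
      ind a2 (negS m21) m11 (Mult-neg m21-mult) (Mult-const m11-const) relation₂ λ (_ , z11) →
      independent-nonzero {ξ2 = ξ2} ind (≈SD-trans ξ1≈ (combS-zero θ1 θ2 z11 (negS-zero z12)))
      where
      D≈0 : D ≈S 0S
      D≈0 zero = D0≈0
      D≈0 (suc k) = D-const (suc k) (s≤s z≤n)
      relation₁ : combS m22 ξ1 (negS m12) ξ2 ≈SD 0SD
      relation₁ =
        ≈S-trans (adjugate₁ m11 m12 m21 m22 (proj₁ θ1) (proj₁ θ2) (proj₁ ξ1) (proj₁ ξ2) (proj₁ ξ1≈) (proj₁ ξ2≈)) (⋆-zeroˡ (proj₁ θ1) D≈0) ,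
        ≈S-trans (adjugate₁ m11 m12 m21 m22 (proj₂ θ1) (proj₂ θ2) (proj₂ ξ1) (proj₂ ξ2) (proj₂ ξ1≈) (proj₂ ξ2≈)) (⋆-zeroˡ (proj₂ θ1) D≈0)
      relation₂ : combS (negS m21) ξ1 m11 ξ2 ≈SD 0SD
      relation₂ =
        ≈S-trans (adjugate₂ m11 m12 m21 m22 (proj₁ θ1) (proj₁ θ2) (proj₁ ξ1) (proj₁ ξ2) (proj₁ ξ1≈) (proj₁ ξ2≈)) (⋆-zeroˡ (proj₁ θ2) D≈0) ,
        ≈S-trans (adjugate₂ m11 m12 m21 m22 (proj₂ θ1) (proj₂ θ2) (proj₂ ξ1) (proj₂ ξ2) (proj₂ ξ1≈) (proj₂ ξ2≈)) (⋆-zeroˡ (proj₂ θ2) D≈0)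

    C : Seq
    C = proj₁ (inverse (D 0) D-nonzero) ·S 1S

    C-const : Deg≤ 0 C
    C-const = Deg≤-· _ Deg≤-1S

    C⋆D≈1 : C ⋆ D ≈S 1S
    C⋆D≈1 k = trans (⋆-comm C D k) (trans (const-⋆ C D-const k)
               (trans (sym (*-assoc _ _ _)) (trans (*-cong (proj₂ (inverse (D 0) D-nonzero)) refl) (*-identityˡ _))))

    spans : ∀ k δ → DerDeg≤ k δ → InDS κ k δ →
            Σ Seq λ g1 → Σ Seq λ g2 → Mult k a1 g1 × Mult k a2 g2 × (δ ≈SD combS g1 ξ1 g2 ξ2)
    spans k δ bδ mδ =
      C ⋆ (h1 ⋆ m22 +S h2 ⋆ negS m21) , C ⋆ (h1 ⋆ negS m12 +S h2 ⋆ m11) ,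
      Mult-⋆-Mult (Mult-const C-const) (Mult-+ (Mult-⋆-Mult h1-mult m22-mult') (Mult-⋆-Mult h2-mult (Mult-neg m21-mult))) ,
      Mult-⋆-Mult (Mult-const C-const) (Mult-+ (Mult-⋆-Mult h1-mult (Mult-neg m12-mult)) (Mult-⋆-Mult h2-mult m11-mult')) ,
      (cramer C h1 h2 m11 m12 m21 m22 (proj₁ θ1) (proj₁ θ2) (proj₁ ξ1) (proj₁ ξ2) (proj₁ δ) C⋆D≈1 (proj₁ δ≈) (proj₁ ξ1≈) (proj₁ ξ2≈) ,
       cramer C h1 h2 m11 m12 m21 m22 (proj₂ θ1) (proj₂ θ2) (proj₂ ξ1) (proj₂ ξ2) (proj₂ δ) C⋆D≈1 (proj₂ δ≈) (proj₂ ξ1≈) (proj₂ ξ2≈))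
      where
      expansion = SeqBasis.spans B k δ bδ mδ
      h1 = proj₁ expansion
      h2 = proj₁ (proj₂ expansion)
      h1-mult = proj₁ (proj₂ (proj₂ expansion))
      h2-mult = proj₁ (proj₂ (proj₂ (proj₂ expansion)))
      δ≈ = proj₂ (proj₂ (proj₂ (proj₂ expansion)))
      m22-mult' : Mult a1 a1 m22
      m22-mult' = Mult-const m22-const
      m11-mult' : Mult a2 a2 m11
      m11-mult' = Mult-const m11-const

total-mono : ∀ {n} (μ ν : Fin n → ℕ) → (∀ i → μ i ≤ ν i) → total μ ≤ total ν
total-mono {zero} μ ν le = z≤n
total-mono {suc n} μ ν le = NP.+-mono-≤ (le Fin.zero) (total-mono _ _ (λ i → le (Fin.suc i)))

total-equal : ∀ {n} (μ ν : Fin n → ℕ) → (∀ i → μ i ≤ ν i) → total ν ≤ total μ → ∀ i → ν i ≡ μ i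
total-equal {suc n} μ ν le tν≤tμ = pointwise
  where
  tail≤ = total-mono _ _ (λ i → le (Fin.suc i))
  head≡ : ν Fin.zero ≡ μ Fin.zero
  head≡ = NP.≤-antisym (NP.≮⇒≥ λ μ0<ν0 → NP.<⇒≱ (NP.+-mono-<-≤ μ0<ν0 tail≤) tν≤tμ) (le Fin.zero)
  tail-total : total (λ i → ν (Fin.suc i)) ≤ total (λ i → μ (Fin.suc i))
  tail-total = NP.+-cancelˡ-≤ (μ Fin.zero) _ _ (PE.subst (λ x → x ℕ.+ total (λ i → ν (Fin.suc i)) ≤ total μ) head≡ tν≤tμ)
  pointwise : ∀ i → ν i ≡ μ i
  pointwise Fin.zero = head≡
  pointwise (Fin.suc i) = total-equal _ _ (λ i → le (Fin.suc i)) tail-total i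

added-line : ∀ {n} (μ ν : Fin n → ℕ) → μ ⊂· ν →
             Σ (Fin n) λ H0 → (ν H0 ≡ suc (μ H0)) × (∀ H → ¬ (H ≡ H0) → ν H ≡ μ H)
added-line {zero} μ ν (le , ())
added-line {suc n} μ ν (le , tν≡1+tμ) with ν Fin.zero ℕ.≟ μ Fin.zero
... | yes ν0≡μ0 =
  let (H0 , νH0 , ν-other) = added-line (λ i → μ (Fin.suc i)) (λ i → ν (Fin.suc i)) ((λ i → le (Fin.suc i)) , tail-total)
  in Fin.suc H0 , νH0 , λ { Fin.zero _ → ν0≡μ0 ; (Fin.suc H) H≢ → ν-other H (λ e → H≢ (PE.cong Fin.suc e)) }
  where
  tail-total : total (λ i → ν (Fin.suc i)) ≡ suc (total (λ i → μ (Fin.suc i)))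
  tail-total = NP.+-cancelˡ-≡ (μ Fin.zero) _ _
    (PE.trans (PE.trans (PE.cong (ℕ._+ total (λ i → ν (Fin.suc i))) (PE.sym ν0≡μ0)) tν≡1+tμ) (PE.sym (NP.+-suc _ _)))
... | no ν0≢μ0 = Fin.zero , head≡ , λ { Fin.zero H≢ → ⊥-elim (H≢ PE.refl) ; (Fin.suc H) _ → total-equal _ _ (λ i → le (Fin.suc i)) tail-total H }
  where
  tail≤ = total-mono _ _ (λ i → le (Fin.suc i))
  head≤ : ν Fin.zero ≤ suc (μ Fin.zero)
  head≤ = NP.≮⇒≥ λ big → NP.<-irrefl (PE.sym tν≡1+tμ) (NP.+-mono-<-≤ big tail≤)
  head≡ : ν Fin.zero ≡ suc (μ Fin.zero)
  head≡ = NP.≤-antisym head≤ (NP.≤∧≢⇒< (le Fin.zero) (λ e → ν0≢μ0 (PE.sym e)))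
  tail-total : total (λ i → ν (Fin.suc i)) ≤ total (λ i → μ (Fin.suc i))
  tail-total = NP.≤-reflexive (NP.+-cancelˡ-≡ (suc (μ Fin.zero)) _ _
                 (PE.trans (PE.cong (ℕ._+ total (λ i → ν (Fin.suc i))) (PE.sym head≡)) tν≡1+tμ))

same-or-next : ∀ {d e} → d ≤ e → e ≤ suc d → e ≡ d ⊎ e ≡ suc d
same-or-next d≤e e≤1+d with NP.m≤n⇒m<n∨m≡n d≤e
... | inj₁ d<e = inj₂ (NP.≤-antisym e≤1+d d<e)
... | inj₂ d≡e = inj₁ (PE.sym d≡e)

next-gap : ∀ x → ∣ x - suc x ∣ ≡ 1
next-gap x = PE.trans (NP.m≤n⇒∣m-n∣≡n∸m (NP.n≤1+n x)) (NP.m+n∸n≡m 1 x)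

degree-gap : ∀ {d1 d2 e1 e2} → d1 ≤ d2 → e1 ≤ e2 → (d1 ≤ e1) × (d2 ≤ e2) → (e1 ≤ suc d1) × (e2 ≤ suc d2) →
             ¬ (e1 ≡ d1 × e2 ≡ d2) → ¬ (e1 ≡ suc d1 × e2 ≡ suc d2) → ∣ ∣ d1 - d2 ∣ - ∣ e1 - e2 ∣ ∣ ≡ 1
degree-gap {d1} {d2} {e1} {e2} d1≤d2 e1≤e2 (d1≤e1 , d2≤e2) (e1≤1+d1 , e2≤1+d2) not-equal not-raised
  with same-or-next d1≤e1 e1≤1+d1 | same-or-next d2≤e2 e2≤1+d2
... | inj₁ PE.refl | inj₁ PE.refl = ⊥-elim (not-equal (PE.refl , PE.refl))
... | inj₂ PE.refl | inj₂ PE.refl = ⊥-elim (not-raised (PE.refl , PE.refl))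
... | inj₁ PE.refl | inj₂ PE.refl = begin
    ∣ ∣ d1 - d2 ∣ - ∣ d1 - suc d2 ∣ ∣   ≡⟨ PE.cong₂ ∣_-_∣ (NP.m≤n⇒∣m-n∣≡n∸m d1≤d2) (NP.m≤n⇒∣m-n∣≡n∸m e1≤e2) ⟩
    ∣ d2 ∸ d1 - suc d2 ∸ d1 ∣           ≡⟨ PE.cong (∣ d2 ∸ d1 -_∣) (NP.+-∸-assoc 1 d1≤d2) ⟩
    ∣ d2 ∸ d1 - suc (d2 ∸ d1) ∣         ≡⟨ next-gap (d2 ∸ d1) ⟩
    1 ∎
  where open PE.≡-Reasoning
... | inj₂ PE.refl | inj₁ PE.refl = begin
    ∣ ∣ d1 - d2 ∣ - ∣ suc d1 - d2 ∣ ∣   ≡⟨ PE.cong₂ ∣_-_∣ (NP.m≤n⇒∣m-n∣≡n∸m d1≤d2) (NP.m≤n⇒∣m-n∣≡n∸m e1≤e2) ⟩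
    ∣ d2 ∸ d1 - d2 ∸ suc d1 ∣           ≡⟨ PE.cong (∣_- d2 ∸ suc d1 ∣) (NP.+-∸-assoc 1 e1≤e2) ⟩
    ∣ suc (d2 ∸ suc d1) - d2 ∸ suc d1 ∣ ≡⟨ NP.∣-∣-comm (suc (d2 ∸ suc d1)) (d2 ∸ suc d1) ⟩
    ∣ d2 ∸ suc d1 - suc (d2 ∸ suc d1) ∣ ≡⟨ next-gap (d2 ∸ suc d1) ⟩
    1 ∎
  where open PE.≡-Reasoning

module AddedLine {c ℓ} (F : Field c ℓ) (n : ℕ) (α : Fin n → Over.Lin F) (arr : Over.IsArrangement F α)
                 (μ ν : Fin n → ℕ) (H0 : Fin n)
                 (νH0 : ν H0 ≡ suc (μ H0)) (ν-other : ∀ H → ¬ (H ≡ H0) → ν H ≡ μ H) where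
  open Field F hiding (zero)
  open Over F
  open SequenceRing F
  open FormsAsSequences F
  open Cancellation F
  open DerivationAlgebra F
  open Derivations F α
  open DoubleNegation
  open RingProperties ring using (-‿distribʳ-*; x∙y⁻¹≈ε⇒x≈y)

  α₀ : Lin
  α₀ = α H0

  a₀ b₀ : K
  a₀ = proj₁ α₀
  b₀ = proj₂ α₀

  α₀≢0 : NonZeroLin α₀
  α₀≢0 = proj₁ arr H0

  m₀ : ℕ
  m₀ = μ H0

  Dν⊆Dμ : ∀ e δ → InDS ν e δ → InDS μ e δ
  Dν⊆Dμ e δ m H with H Fin.≟ H0
  ... | yes PE.refl = Div-lower (PE.subst (λ k → Div e α₀ k (applyS δ α₀)) νH0 (m H0))
  ... | no H≢H0 = PE.subst (λ k → Div e (α H) k (applyS δ (α H))) (ν-other H H≢H0) (m H)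

  α₀Dμ⊆Dν : ∀ d δ → InDS μ d δ → InDS ν (suc d) (linD α₀ δ)
  α₀Dμ⊆Dν d δ m H with H Fin.≟ H0
  ... | yes PE.refl = PE.subst (λ k → Div (suc d) α₀ k (applyS (linD α₀ δ) α₀)) (PE.sym νH0)
                        (Div-resp (≈S-sym (applyS-linD α₀ δ α₀)) (Div-linS-same (m H0)))
  ... | no H≢H0 = PE.subst (λ k → Div (suc d) (α H) k (applyS (linD α₀ δ) (α H))) (PE.sym (ν-other H H≢H0))
                    (Div-resp (≈S-sym (applyS-linD α₀ δ (α H))) (Div-linS α₀ (m H)))

  -- Multiplication by α₀ preserves independence, α₀ not being a zero divisor.
  α₀-independent : ∀ {d1 d2 θ1 θ2} → SeqBasis μ d1 d2 θ1 θ2 → Independent (suc d1) (suc d2) (linD α₀ θ1) (linD α₀ θ2)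
  α₀-independent {θ1 = θ1} {θ2} B e g1 g2 c1 c2 (zx , zy) =
    linS-cancel α₀ α₀≢0 (cancel-form (g1 ⋆ proj₁ θ1 +S g2 ⋆ proj₁ θ2) (proj₁ pull) zx) >>= λ zx' →
    linS-cancel α₀ α₀≢0 (cancel-form (g1 ⋆ proj₂ θ1 +S g2 ⋆ proj₂ θ2) (proj₂ pull) zy) >>= λ zy' →
    return (SeqBasis.indep B (e ∸ 1) g1 g2 (Mult-pred c1) (Mult-pred c2) (zx' , zy'))
    where
    pull = combS-linD α₀ g1 θ1 g2 θ2
    cancel-form : ∀ {s} t → s ≈S linS α₀ ⋆ t → s ≈S 0S → linS α₀ ⋆ t ≈S linS α₀ ⋆ 0S
    cancel-form t e z = ≈S-trans (≈S-sym e) (≈S-trans z (≈S-sym (⋆-zeroʳ (linS α₀) ≈S-refl)))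

  κ₀ : Fin n → ℕ
  κ₀ H with H Fin.≟ H0
  ... | yes _ = 0
  ... | no _ = μ H

  κ₀-other : ∀ H → ¬ (H ≡ H0) → κ₀ H ≡ μ H
  κ₀-other H H≢H0 with H Fin.≟ H0
  ... | yes H≡H0 = ⊥-elim (H≢H0 H≡H0)
  ... | no _ = PE.refl

  R : Seq
  R = prodPow n α κ₀

  r : ℕ
  r = total κ₀

  R-deg : Deg≤ r R
  R-deg = prodPow-deg n α κ₀

  R-divisible : ∀ H → ¬ (H ≡ H0) → Σ Seq λ h → Deg≤ (r ∸ μ H) h × (R ≈S powS (α H) (μ H) ⋆ h) × (μ H ≤ r)
  R-divisible H H≢H0 = h , Deg≤-≡ (PE.cong (r ∸_) κ≡) h-deg ,
                       ≈S-trans eq (λ k → reflexive (PE.cong (λ m → (powS (α H) m ⋆ h) k) κ≡)) ,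
                       PE.subst (_≤ r) κ≡ (≤-total κ₀ H)
    where
    κ≡ = κ₀-other H H≢H0
    factor = prodPow-divisible n α κ₀ H
    h = proj₁ factor
    h-deg = proj₁ (proj₂ factor)
    eq = proj₂ (proj₂ factor)

  -- Evaluation at the point p = (b₀, −a₀) of the line H₀.
  open Evaluation F b₀ (- a₀)

  α₀-vanishes : a₀ * b₀ + b₀ * (- a₀) ≈ 0#
  α₀-vanishes = trans (+-cong (*-comm a₀ b₀) (sym (-‿distribʳ-* b₀ a₀))) (-‿inverseʳ _)

  α₀-multiple-vanishes : ∀ e {h} → Mult e 1 h → eval (linS α₀ ⋆ h) e ≈ 0#
  α₀-multiple-vanishes zero (_ , h≈0) = eval-zero 0 (⋆-zeroʳ (linS α₀) (h≈0 (s≤s z≤n)))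
  α₀-multiple-vanishes (suc e) (h-deg , _) =
    trans (eval-⋆ 1 e (linS-deg α₀) h-deg) (trans (*-cong (trans (eval-linS α₀) α₀-vanishes) refl) (zeroˡ _))

  other-line-nonvanishing : ∀ H → ¬ (H ≡ H0) → ¬ (eval (linS (α H)) 1 ≈ 0#)
  other-line-nonvanishing H H≢H0 αH[p]≈0 =
    proportional⇒SameLine α₀ (α H) α₀≢0 (proj₁ arr H) proportional (proj₂ arr H0 H (λ e → H≢H0 (PE.sym e)))
    where
    a = proj₁ (α H)
    b = proj₂ (α H)
    proportional : b₀ * a ≈ a₀ * b
    proportional = trans (*-comm b₀ a) (x∙y⁻¹≈ε⇒x≈y (a * b₀) (a₀ * b) (begin
      a * b₀ + - (a₀ * b)   ≈⟨ +-cong refl (trans (-‿cong (*-comm a₀ b)) (-‿distribʳ-* b a₀)) ⟩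
      a * b₀ + b * (- a₀)   ≈⟨ sym (eval-linS (α H)) ⟩
      eval (linS (α H)) 1   ≈⟨ αH[p]≈0 ⟩
      0# ∎))
      where open SetoidReasoning setoid

  R-nonvanishing : ¬ (eval R r ≈ 0#)
  R-nonvanishing = prodPow-nonzero n α κ₀ factor
    where
    factor : ∀ H → κ₀ H ≡ 0 ⊎ ¬ (eval (linS (α H)) 1 ≈ 0#)
    factor H with H Fin.≟ H0
    ... | yes PE.refl = inj₁ PE.refl
    ... | no H≢H0 = inj₂ (other-line-nonvanishing H H≢H0)

  -- ρ = R (b₀ ∂x − a₀ ∂y) kills α₀, so it lies in D(ν).
  ρ : SDer
  ρ = b₀ ·S R , (- a₀) ·S R

  ρ-deg : DerDeg≤ r ρ
  ρ-deg = Deg≤-· b₀ R-deg , Deg≤-· (- a₀) R-deg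

  ρ∈Dν : InDS ν r ρ
  ρ∈Dν H with H Fin.≟ H0
  ... | yes PE.refl = 0S , Mult-0S r (ν H0) ,
        ≈S-trans (applyS-· b₀ (- a₀) R α₀)
          (λ k → trans (*-cong α₀-vanishes refl) (trans (zeroˡ _) (sym (⋆-zeroʳ (powS α₀ (ν H0)) ≈S-refl k))))
  ... | no H≢H0 = let (h , h-deg , eq , μH≤r) = R-divisible H H≢H0 in
        PE.subst (λ m → Div r (α H) m (applyS ρ (α H))) (PE.sym (ν-other H H≢H0))
          (Div-resp (≈S-sym (applyS-· b₀ (- a₀) R (α H))) (Div-· _ eq h-deg μH≤r))

  -- ρ is not in α₀ D(μ): the multiples of α₀ vanish at p, while the
  -- coefficients b₀ R, −a₀ R of ρ do not both vanish there.
  ρ∉α₀D : ∀ {d1 d2 θ1 θ2} → DerDeg≤ d1 θ1 → DerDeg≤ d2 θ2 → ∀ g1 g2 → Mult r (suc d1) g1 → Mult r (suc d2) g2 →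
          ¬ (ρ ≈SD combS g1 (linD α₀ θ1) g2 (linD α₀ θ2))
  ρ∉α₀D {d1} {d2} {θ1} {θ2} (b11 , b12) (b21 , b22) g1 g2 c1 c2 (eqx , eqy) =
    α₀≢0 (-‿injective (trans (coefficient-vanishes (- a₀) b12 b22 (≈S-trans eqy (proj₂ pull))) (sym -0#≈0#)) ,
          coefficient-vanishes b₀ b11 b21 (≈S-trans eqx (proj₁ pull)))
    where
    open RingProperties ring using (-‿injective; -0#≈0#)
    pull = combS-linD α₀ g1 θ1 g2 θ2
    coefficient-vanishes : ∀ x {p1 p2} → Deg≤ d1 p1 → Deg≤ d2 p2 → x ·S R ≈S linS α₀ ⋆ (g1 ⋆ p1 +S g2 ⋆ p2) → x ≈ 0#
    coefficient-vanishes x {p1} {p2} bp1 bp2 eq = *-zero-cancelʳ R-nonvanishing (begin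
        x * eval R r                               ≈⟨ sym (eval-· x R r) ⟩
        eval (x ·S R) r                            ≈⟨ eval-cong r eq ⟩
        eval (linS α₀ ⋆ (g1 ⋆ p1 +S g2 ⋆ p2)) r     ≈⟨ α₀-multiple-vanishes r
                                                           (Mult-+ (Mult-⋆-Mult c1 (Deg≤⇒Mult bp1)) (Mult-⋆-Mult c2 (Deg≤⇒Mult bp2))) ⟩
        0# ∎)
      where open SetoidReasoning setoid

  -- σ = α₀^m₀ R (s ∂x + t ∂y) with α₀(s, t) = 1 lies in D(μ) but not in D(ν),
  -- since σ(α₀) = α₀^m₀ R and α₀ does not divide R.
  module Leaver (s t : K) (α₀[s,t]≈1 : a₀ * s + b₀ * t ≈ 1#) where
    Q : Seq
    Q = powS α₀ m₀ ⋆ R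

    σ : SDer
    σ = s ·S Q , t ·S Q

    σ-deg : DerDeg≤ (m₀ ℕ.+ r) σ
    σ-deg = Deg≤-· s Q-deg , Deg≤-· t Q-deg
      where Q-deg = Deg≤-⋆ (powS-deg α₀ m₀) R-deg

    σ-α₀ : applyS σ α₀ ≈S Q
    σ-α₀ = ≈S-trans (applyS-· s t Q α₀) (λ k → trans (*-cong α₀[s,t]≈1 refl) (*-identityˡ _))

    σ∈Dμ : InDS μ (m₀ ℕ.+ r) σ
    σ∈Dμ H with H Fin.≟ H0
    ... | yes PE.refl = R , (Deg≤-≡ (PE.sym (NP.m+n∸m≡n m₀ r)) R-deg , λ lt → ⊥-elim (NP.<⇒≱ lt (NP.m≤m+n m₀ r))) ,
          σ-α₀
    ... | no H≢H0 = let (h , h-deg , eq , μH≤r) = R-divisible H H≢H0 in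
          Div-resp (≈S-sym (applyS-· s t Q (α H)))
            (Div-· _ (≈S-trans (⋆-congˡ (powS α₀ m₀) eq) (⋆-exchange (powS α₀ m₀) (powS (α H) (μ H)) h))
                 (Deg≤-≡ (PE.sym (NP.+-∸-assoc m₀ μH≤r)) (Deg≤-⋆ (powS-deg α₀ m₀) h-deg))
                 (NP.≤-trans μH≤r (NP.m≤n+m r m₀)))

    σ∉Dν : ¬ InDS ν (m₀ ℕ.+ r) σ
    σ∉Dν σ∈Dν = powS-cancel α₀ m₀ α₀≢0 Q≈α₀^m₀α₀h λ R≈α₀h →
        R-nonvanishing (trans (eval-cong r R≈α₀h) (α₀-multiple-vanishes r (Mult-cancel m₀ h-mult')))
      where
      divisible = PE.subst (λ k → Div (m₀ ℕ.+ r) α₀ k (applyS σ α₀)) νH0 (σ∈Dν H0)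
      h = proj₁ divisible
      h-mult' : Mult (m₀ ℕ.+ r) (m₀ ℕ.+ 1) h
      h-mult' = PE.subst (λ k → Mult (m₀ ℕ.+ r) k h) (NP.+-comm 1 m₀) (proj₁ (proj₂ divisible))
      Q≈α₀^m₀α₀h : powS α₀ m₀ ⋆ R ≈S powS α₀ m₀ ⋆ (linS α₀ ⋆ h)
      Q≈α₀^m₀α₀h = ≈S-trans (≈S-sym σ-α₀) (≈S-trans (proj₂ (proj₂ divisible))
                     (≈S-trans (powS-suc-⋆ α₀ m₀ h) (⋆-exchange (linS α₀) (powS α₀ m₀) h)))

  module Comparison {d1 d2 θ1 θ2 e1 e2 η1 η2} (Bμ : SeqBasis μ d1 d2 θ1 θ2) (Bν : SeqBasis ν e1 e2 η1 η2)
                    (d1≤d2 : d1 ≤ d2) (e1≤e2 : e1 ≤ e2) where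
    private
      module Bμ = SeqBasis Bμ
      module Bν = SeqBasis Bν

    -- The basis of D(ν) is an independent pair in D(μ).
    degrees-rise : (d1 ≤ e1) × (d2 ≤ e2)
    degrees-rise = independent-degrees Bμ d1≤d2 e1≤e2 Bν.deg1 Bν.deg2
                     (Dν⊆Dμ e1 η1 Bν.mem1) (Dν⊆Dμ e2 η2 Bν.mem2) (independent Bν)

    -- α₀ θ₁, α₀ θ₂ are an independent pair in D(ν).
    degrees-rise-by-at-most-one : (e1 ≤ suc d1) × (e2 ≤ suc d2)
    degrees-rise-by-at-most-one = independent-degrees Bν e1≤e2 (s≤s d1≤d2) (linD-deg α₀ Bμ.deg1) (linD-deg α₀ Bμ.deg2)
                                    (α₀Dμ⊆Dν d1 θ1 Bμ.mem1) (α₀Dμ⊆Dν d2 θ2 Bμ.mem2) (α₀-independent Bμ)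

    -- Otherwise η₁, η₂ would be a basis of D(μ), putting σ into D(ν).
    not-both-equal : ¬ (e1 ≡ d1 × e2 ≡ d2)
    not-both-equal (PE.refl , PE.refl) = dual-vector α₀ α₀≢0 λ (s , t , α₀[s,t]≈1) →
      let open Leaver s t α₀[s,t]≈1
          (g1 , g2 , c1 , c2 , σ≈) = SameDegrees.spans Bμ Bν.deg1 Bν.deg2 (Dν⊆Dμ e1 η1 Bν.mem1) (Dν⊆Dμ e2 η2 Bν.mem2)
                                       (independent Bν) (m₀ ℕ.+ r) σ σ-deg σ∈Dμ
      in σ∉Dν (InDS-resp (≈SD-sym σ≈) (InDS-comb Bν.mem1 Bν.mem2 c1 c2))

    -- Otherwise α₀ θ₁, α₀ θ₂ would be a basis of D(ν), putting ρ into α₀ D(μ).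
    not-both-raised : ¬ (e1 ≡ suc d1 × e2 ≡ suc d2)
    not-both-raised (PE.refl , PE.refl) =
      let (g1 , g2 , c1 , c2 , ρ≈) = SameDegrees.spans Bν (linD-deg α₀ Bμ.deg1) (linD-deg α₀ Bμ.deg2)
                                       (α₀Dμ⊆Dν d1 θ1 Bμ.mem1) (α₀Dμ⊆Dν d2 θ2 Bμ.mem2) (α₀-independent Bμ) r ρ ρ-deg ρ∈Dν
      in ρ∉α₀D Bμ.deg1 Bμ.deg2 g1 g2 c1 c2 ρ≈

  gap-sorted : ∀ {d1 d2 θ1 θ2 e1 e2 η1 η2} → SeqBasis μ d1 d2 θ1 θ2 → SeqBasis ν e1 e2 η1 η2 →
               d1 ≤ d2 → e1 ≤ e2 → ∣ ∣ d1 - d2 ∣ - ∣ e1 - e2 ∣ ∣ ≡ 1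
  gap-sorted Bμ Bν d1≤d2 e1≤e2 =
    degree-gap d1≤d2 e1≤e2 degrees-rise degrees-rise-by-at-most-one not-both-equal not-both-raised
    where open Comparison Bμ Bν d1≤d2 e1≤e2

  gap : ∀ {d1 d2 θ1 θ2 e1 e2 η1 η2} → SeqBasis μ d1 d2 θ1 θ2 → SeqBasis ν e1 e2 η1 η2 →
        ∣ ∣ d1 - d2 ∣ - ∣ e1 - e2 ∣ ∣ ≡ 1
  gap {d1} {d2} {e1 = e1} {e2} Bμ Bν with NP.≤-total d1 d2 | NP.≤-total e1 e2
  ... | inj₁ d1≤d2 | inj₁ e1≤e2 = gap-sorted Bμ Bν d1≤d2 e1≤e2
  ... | inj₂ d2≤d1 | inj₁ e1≤e2 = PE.subst (λ x → ∣ x - ∣ e1 - e2 ∣ ∣ ≡ 1) (NP.∣-∣-comm d2 d1)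
                                    (gap-sorted (swapBasis Bμ) Bν d2≤d1 e1≤e2)
  ... | inj₁ d1≤d2 | inj₂ e2≤e1 = PE.subst (λ x → ∣ ∣ d1 - d2 ∣ - x ∣ ≡ 1) (NP.∣-∣-comm e2 e1)
                                    (gap-sorted Bμ (swapBasis Bν) d1≤d2 e2≤e1)
  ... | inj₂ d2≤d1 | inj₂ e2≤e1 = PE.subst₂ (λ x y → ∣ x - y ∣ ≡ 1) (NP.∣-∣-comm d2 d1) (NP.∣-∣-comm e2 e1)
                                    (gap-sorted (swapBasis Bμ) (swapBasis Bν) d2≤d1 e2≤e1)

lemma4p2 : ∀ {c ℓ : Level} (F : Field c ℓ) (n : ℕ)
    (α : Fin n → Over.Lin F) → Over.IsArrangement F α →
    (μ ν : Fin n → ℕ) → μ ⊂· ν →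
    ∀ (d₁ d₂ : ℕ) (θ₁ : Over.Der F d₁) (θ₂ : Over.Der F d₂) →
    Over.HomBasis F α μ d₁ d₂ θ₁ θ₂ →
    ∀ (e₁ e₂ : ℕ) (η₁ : Over.Der F e₁) (η₂ : Over.Der F e₂) →
    Over.HomBasis F α ν e₁ e₂ η₁ η₂ →
    ∣ ∣ d₁ - d₂ ∣ - ∣ e₁ - e₂ ∣ ∣ ≡ 1
lemma4p2 F n α arr μ ν μ⊂·ν d₁ d₂ θ₁ θ₂ Bμ e₁ e₂ η₁ η₂ Bν =
  let (H0 , νH0 , ν-other) = added-line μ ν μ⊂·ν
  in AddedLine.gap F n α arr μ ν H0 νH0 ν-other (Derivations.toSeqBasis F α Bμ) (Derivations.toSeqBasis F α Bν)
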